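{- In the field $\mathbb{Q}((t^{ -1}))$, the equation $3x^3-3tx^2+9x-t=0$ has a unique solution $x$ with $\deg x>0$, and this $x$ has the continued fraction expansion with $\beta_0=1$, $a_0=t$ and, for all $i\ge 1$, $$\beta_i=(3i-1)(3i+1),\qquad a_i=(-1)^i(2i+1)t.$$
   Context: $\mathbb{Q}((t^{ -1}))$ is the field of formal Laurent series $\sum_{k\ge -d}c_kt^{ -k}$, $c_k\in\mathbb{Q}$; the degree of a nonzero series is the largest $d$ with $c_{ -d}\ne0$. Given nonzero rationals $\beta_0,\beta_1,\dots$ and polynomials $a_0,a_1,\dots\in\mathbb{Q}[t]$ with $\deg a_i\ge 1$ for $i\ge1$, a series $x$ is said to have the continued fraction expansion $\frac{1}{\beta_0}\Big(a_0+\cfrac{\beta_1}{a_1+\cfrac{\beta_2}{a_2+\cdots}}\Big)$ if, setting $x_0=x$ and $x_{i+1}=1/(\beta_ix_i-a_i)$, for every $i\ge0$ one has $\beta_ix_i-a_i\ne0$ and $\deg(\beta_ix_i-a_i)<0$. -}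

module Defs where

open import Data.Nat as ℕ using (ℕ; zero; suc; _∸_)
open import Data.Integer as ℤ using (ℤ; +_; -[1+_])
open import Data.Rational as ℚ using (ℚ; 0ℚ; 1ℚ; _/_)
open import Data.Product using (Σ; _×_)
open import Relation.Binary.PropositionalEquality using (_≡_; _≢_)

-- A formal Laurent series in t⁻¹ over ℚ, represented as a pair (N , f)
-- standing for  Σ_{j ≥ 0} f j · t^(N - j).  Every element of ℚ((t⁻¹))
-- has such a representation (the exponents of t are bounded above).
record Laurent : Set where
  constructor lau
  field
    top : ℤ
    cf  : ℕ → ℚ
open Laurent public

coeff : Laurent → ℤ → ℚ
coeff (lau N f) k with N ℤ.- k
... | + n      = f n
... | -[1+ _ ] = 0ℚ

infix 4 _≈_
_≈_ : Laurent → Laurent → Set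
x ≈ y = ∀ (k : ℤ) → coeff x k ≡ coeff y k

convAux : (ℕ → ℚ) → (ℕ → ℚ) → ℕ → ℕ → ℚ
convAux f g n zero    = f 0 ℚ.* g n
convAux f g n (suc m) = convAux f g n m ℚ.+ f (suc m) ℚ.* g (n ∸ suc m)

infixl 6 _+L_ _-L_
infixl 7 _*L_ _·L_

_+L_ : Laurent → Laurent → Laurent
x +L y = lau L (λ n → coeff x (L ℤ.- + n) ℚ.+ coeff y (L ℤ.- + n))
  where L = top x ℤ.⊔ top y

_·L_ : ℚ → Laurent → Laurent
c ·L lau N f = lau N (λ n → c ℚ.* f n)

-L_ : Laurent → Laurent
-L x = (ℚ.- 1ℚ) ·L x

_-L_ : Laurent → Laurent → Laurent
x -L y = x +L (-L y)

_*L_ : Laurent → Laurent → Laurent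
lau N f *L lau M g = lau (N ℤ.+ M) (λ n → convAux f g n n)

const : ℚ → Laurent
const c = lau (+ 0) (λ { zero → c ; (suc _) → 0ℚ })

0L 1L tL : Laurent
0L = const 0ℚ
1L = const 1ℚ
tL = lau (+ 1) (λ { zero → 1ℚ ; (suc _) → 0ℚ })

-- "deg x = d": the largest d with nonzero coefficient of t^d
-- (in the paper's notation, c_{-d} ≠ 0 and c_{-k} = 0 for k > d)
HasDeg : Laurent → ℤ → Set
HasDeg x d = (coeff x d ≢ 0ℚ) × (∀ k → d ℤ.< k → coeff x k ≡ 0ℚ)

-- continued fraction expansion (1/β₀)(a₀ + β₁/(a₁ + β₂/(a₂ + ⋯))):
-- a sequence x₀ = x, x_{i+1} = 1/(β_i x_i − a_i) with deg(β_i x_i − a_i) < 0.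
-- The reciprocal is expressed as  (β_i x_i − a_i) · x_{i+1} = 1, which
-- determines x_{i+1} uniquely (and forces β_i x_i − a_i ≠ 0).
HasCF : Laurent → (ℕ → ℚ) → (ℕ → Laurent) → Set
HasCF x β a =
  Σ (ℕ → Laurent) λ xs →
    (xs 0 ≈ x) ×
    (∀ i → Σ ℤ (λ d → (d ℤ.< + 0) × HasDeg (β i ·L xs i -L a i) d)
           × ((β i ·L xs i -L a i) *L xs (suc i) ≈ 1L))

qz : ℤ → ℚ
qz z = z / 1

cubic : Laurent → Laurent
cubic x = qz (+ 3) ·L (x *L x *L x) -L qz (+ 3) ·L (tL *L x *L x)
          +L qz (+ 9) ·L x -L tL

β : ℕ → ℚ
β zero    = 1ℚ
β (suc j) = qz ((+ 3 ℤ.* + suc j ℤ.- + 1) ℤ.* (+ 3 ℤ.* + suc j ℤ.+ + 1))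

sgn : ℕ → ℤ
sgn zero    = + 1
sgn (suc i) = ℤ.- sgn i

a : ℕ → Laurent
a zero    = tL
a (suc j) = qz (sgn (suc j) ℤ.* (+ 2 ℤ.* + suc j ℤ.+ + 1)) ·L tL

-- Write u = t⁻¹ and x = t^d·g(u) with g ∈ ℚ[[u]], g(0) ≠ 0. The top coefficient of the cubic
-- is 3g(0)³ when d ≥ 2, so d = 1; then the cubic reads 3g³ − 3g² + 9u²g − u² = 0, whose linear
-- part at g(0) = 1 is multiplication by 3, so the solution is unique and is the u-adic limit of
-- Newton's method.
--
-- Differentiating the cubic shows that x satisfies the Riccati equation (t² − 9)x′ = x² − 1.
-- If a complete quotient xᵢ = t·gᵢ(u) satisfies (t² − 9)xᵢ′ = Bᵢxᵢ² + Qᵢtxᵢ + Dᵢ, the three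
-- leading coefficients of this equation force βᵢxᵢ − aᵢ to have degree −1, and the substitution
-- x ↦ 1/(βᵢx − aᵢ) turns it into the same kind of equation for xᵢ₊₁, with
-- Bᵢ₊₁ = −βᵢDᵢ − 9Aᵢ, Qᵢ₊₁ = Qᵢ − 2, Dᵢ₊₁ = −Bᵢ/βᵢ (aᵢ = Aᵢt). The values Bᵢ = ±βᵢ, Qᵢ = −2i,
-- Dᵢ = ±1 are consistent with this recursion, and induction on i gives the whole expansion.

module Submission where

open import Data.Nat as ℕ using (ℕ; zero; suc; _∸_; z≤n; s≤s)
import Data.Nat.Properties as ℕP
open import Data.Integer as ℤ using (ℤ; +_; -[1+_]; +<+; -<+)
import Data.Integer.Properties as ℤP
import Data.Integer.Tactic.RingSolver as ℤ-Tactic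
open import Data.Rational as ℚ using (ℚ; 0ℚ; 1ℚ; _+_; _*_; -_; _-_; 1/_; toℚᵘ; ≢-nonZero)
open import Data.Rational.Properties
import Data.Rational.Unnormalised as ℚᵘ
import Data.Rational.Unnormalised.Properties as ℚᵘP
open import Data.Product using (Σ; _×_; _,_)
open import Data.Sum using (inj₁; inj₂)
open import Data.Maybe using (Maybe; just; nothing)
open import Data.Unit using (⊤; tt)
open import Function using (_∘_)
open import Level using (0ℓ)
open import Relation.Binary.PropositionalEquality
open import Relation.Nullary using (yes; no; contradiction)
open import Algebra.Bundles using (CommutativeRing)
import Algebra.Properties.Group as GroupProperties
import Relation.Binary.Reasoning.Setoid as SetoidReasoning
import Algebra.Solver.Ring as RingSolver
import Algebra.Solver.Ring.AlmostCommutativeRing as ACR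
import Tactic.RingSolver.Core.AlmostCommutativeRing as TACR
open import Tactic.RingSolver using (solve-∀)
open import Defs

ℚ-ring : TACR.AlmostCommutativeRing 0ℓ 0ℓ
ℚ-ring = TACR.fromCommutativeRing +-*-commutativeRing 0≟
  where
  0≟ : ∀ p → Maybe (0ℚ ≡ p)
  0≟ p with 0ℚ ≟ p
  ... | yes e = just e
  ... | no _  = nothing

open GroupProperties +-0-group using ()
  renaming (x∙y⁻¹≈ε⇒x≈y to p-q≡0⇒p≡q; x≈y⇒x∙y⁻¹≈ε to p≡q⇒p-q≡0)

p*q≡0⇒q≡0 : ∀ {p q} → p ≢ 0ℚ → p * q ≡ 0ℚ → q ≡ 0ℚ
p*q≡0⇒q≡0 {p} {q} p≢0 pq≡0 = begin
  q                ≡⟨ *-identityˡ q ⟨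
  1ℚ * q           ≡⟨ cong (_* q) (*-inverseˡ p) ⟨
  (1/ p) * p * q   ≡⟨ *-assoc (1/ p) p q ⟩
  (1/ p) * (p * q) ≡⟨ cong ((1/ p) *_) pq≡0 ⟩
  (1/ p) * 0ℚ      ≡⟨ *-zeroʳ (1/ p) ⟩
  0ℚ               ∎
  where
  open ≡-Reasoning
  instance _ = ≢-nonZero p≢0

p≢0∧q≢0⇒p*q≢0 : ∀ {p q} → p ≢ 0ℚ → q ≢ 0ℚ → p * q ≢ 0ℚ
p≢0∧q≢0⇒p*q≢0 p≢0 q≢0 = q≢0 ∘ p*q≡0⇒q≡0 p≢0

private
  toℚᵘ-qz : ∀ z → toℚᵘ (qz z) ℚᵘ.≃ ℚᵘ.mkℚᵘ z 0
  toℚᵘ-qz z = toℚᵘ-fromℚᵘ (ℚᵘ.mkℚᵘ z 0)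

qz-homo-+ : ∀ i j → qz (i ℤ.+ j) ≡ qz i + qz j
qz-homo-+ i j = toℚᵘ-injective (ℚᵘP.≃-trans (toℚᵘ-qz (i ℤ.+ j)) (ℚᵘP.≃-sym
  (ℚᵘP.≃-trans (toℚᵘ-homo-+ (qz i) (qz j))
  (ℚᵘP.≃-trans (ℚᵘP.+-cong (toℚᵘ-qz i) (toℚᵘ-qz j))
  (ℚᵘ.*≡* (cong (ℤ._* + 1) (cong₂ ℤ._+_ (ℤP.*-identityʳ i) (ℤP.*-identityʳ j))))))))

qz-homo-* : ∀ i j → qz (i ℤ.* j) ≡ qz i * qz j
qz-homo-* i j = toℚᵘ-injective (ℚᵘP.≃-trans (toℚᵘ-qz (i ℤ.* j)) (ℚᵘP.≃-sym
  (ℚᵘP.≃-trans (toℚᵘ-homo-* (qz i) (qz j))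
  (ℚᵘP.≃-trans (ℚᵘP.*-cong (toℚᵘ-qz i) (toℚᵘ-qz j)) (ℚᵘ.*≡* refl)))))

qz-homo‿- : ∀ i → qz (ℤ.- i) ≡ - qz i
qz-homo‿- i = toℚᵘ-injective (ℚᵘP.≃-trans (toℚᵘ-qz (ℤ.- i)) (ℚᵘP.≃-sym
  (ℚᵘP.≃-trans (toℚᵘ-homo‿- (qz i))
  (ℚᵘP.≃-trans (ℚᵘP.-‿cong (toℚᵘ-qz i)) (ℚᵘ.*≡* refl)))))

qz≡0⇒≡0 : ∀ {z} → qz z ≡ 0ℚ → z ≡ + 0
qz≡0⇒≡0 {z} e with ℚᵘP.≃-trans (ℚᵘP.≃-sym (toℚᵘ-qz z)) (ℚᵘP.≃-reflexive (cong toℚᵘ e))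
... | ℚᵘ.*≡* eq = trans (sym (ℤP.*-identityʳ z)) eq

qz-suc≢0 : ∀ n → qz (+ suc n) ≢ 0ℚ
qz-suc≢0 n e with qz≡0⇒≡0 {+ suc n} e
... | ()

sumTo : (ℕ → ℚ) → ℕ → ℚ
sumTo F zero    = F 0
sumTo F (suc m) = sumTo F m + F (suc m)

sumTo-cong : ∀ {F G} m → (∀ j → j ℕ.≤ m → F j ≡ G j) → sumTo F m ≡ sumTo G m
sumTo-cong zero    F≡G = F≡G 0 z≤n
sumTo-cong (suc m) F≡G =
  cong₂ _+_ (sumTo-cong m (λ j j≤m → F≡G j (ℕP.m≤n⇒m≤1+n j≤m))) (F≡G (suc m) ℕP.≤-refl)

sumTo-+ : ∀ F G m → sumTo (λ j → F j + G j) m ≡ sumTo F m + sumTo G m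
sumTo-+ F G zero    = refl
sumTo-+ F G (suc m) = trans (cong (_+ (F (suc m) + G (suc m))) (sumTo-+ F G m))
                            (swap (sumTo F m) (sumTo G m) (F (suc m)) (G (suc m)))
  where
  swap : ∀ a b c d → (a + b) + (c + d) ≡ (a + c) + (b + d)
  swap = solve-∀ ℚ-ring

sumTo-*ˡ : ∀ c F m → sumTo (λ j → c * F j) m ≡ c * sumTo F m
sumTo-*ˡ c F zero    = refl
sumTo-*ˡ c F (suc m) =
  trans (cong (_+ (c * F (suc m))) (sumTo-*ˡ c F m)) (sym (*-distribˡ-+ c (sumTo F m) (F (suc m))))

sumTo-*ʳ : ∀ c F m → sumTo (λ j → F j * c) m ≡ sumTo F m * c
sumTo-*ʳ c F m = begin
  sumTo (λ j → F j * c) m ≡⟨ sumTo-cong m (λ j _ → *-comm (F j) c) ⟩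
  sumTo (λ j → c * F j) m ≡⟨ sumTo-*ˡ c F m ⟩
  c * sumTo F m           ≡⟨ *-comm c (sumTo F m) ⟩
  sumTo F m * c           ∎
  where open ≡-Reasoning

sumTo-zero : ∀ m → sumTo (λ _ → 0ℚ) m ≡ 0ℚ
sumTo-zero zero    = refl
sumTo-zero (suc m) = cong (_+ 0ℚ) (sumTo-zero m)

sumTo-unconsˡ : ∀ F m → sumTo F (suc m) ≡ F 0 + sumTo (F ∘ suc) m
sumTo-unconsˡ F zero    = refl
sumTo-unconsˡ F (suc m) = trans (cong (_+ F (suc (suc m))) (sumTo-unconsˡ F m)) (+-assoc (F 0) _ _)

sumTo-reverse : ∀ F m → sumTo F m ≡ sumTo (λ j → F (m ∸ j)) m
sumTo-reverse F zero    = refl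
sumTo-reverse F (suc m) = begin
  sumTo F m + F (suc m)                     ≡⟨ cong (_+ F (suc m)) (sumTo-reverse F m) ⟩
  sumTo (λ j → F (m ∸ j)) m + F (suc m)     ≡⟨ +-comm _ (F (suc m)) ⟩
  F (suc m) + sumTo (λ j → F (m ∸ j)) m     ≡⟨ sumTo-unconsˡ (λ j → F (suc m ∸ j)) m ⟨
  sumTo (λ j → F (suc m ∸ j)) (suc m)       ∎
  where open ≡-Reasoning

sumTo-triangle : ∀ (T : ℕ → ℕ → ℚ) n →
  sumTo (λ j → sumTo (λ i → T i j) j) n ≡ sumTo (λ i → sumTo (λ l → T i (i ℕ.+ l)) (n ∸ i)) n
sumTo-triangle T zero    = refl
sumTo-triangle T (suc n) = begin
    sumTo (λ j → sumTo (λ i → T i j) j) n + sumTo (λ i → T i (suc n)) (suc n)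
  ≡⟨ cong (_+ sumTo (λ i → T i (suc n)) (suc n)) (sumTo-triangle T n) ⟩
    sumTo (row n) n + (sumTo (λ i → T i (suc n)) n + T (suc n) (suc n))
  ≡⟨ +-assoc (sumTo (row n) n) _ _ ⟨
    (sumTo (row n) n + sumTo (λ i → T i (suc n)) n) + T (suc n) (suc n)
  ≡⟨ cong₂ _+_ (sumTo-+ (row n) (λ i → T i (suc n)) n) diagonal ⟨
    sumTo (λ i → row n i + T i (suc n)) n + row (suc n) (suc n)
  ≡⟨ cong (_+ row (suc n) (suc n)) (sumTo-cong n extend) ⟩
    sumTo (row (suc n)) n + row (suc n) (suc n)
  ∎
  where
  open ≡-Reasoning
  row : ℕ → ℕ → ℚ
  row m i = sumTo (λ l → T i (i ℕ.+ l)) (m ∸ i)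
  diagonal : row (suc n) (suc n) ≡ T (suc n) (suc n)
  diagonal = trans (cong (sumTo (λ l → T (suc n) (suc n ℕ.+ l))) (ℕP.n∸n≡0 n))
                   (cong (T (suc n)) (ℕP.+-identityʳ (suc n)))
  extend : ∀ i → i ℕ.≤ n → row n i + T i (suc n) ≡ row (suc n) i
  extend i i≤n = trans (cong (_+_ (row n i)) (cong (T i) (sym i+[1+n-i]≡1+n)))
                       (cong (sumTo (λ l → T i (i ℕ.+ l))) (sym (ℕP.+-∸-assoc 1 i≤n)))
    where
    i+[1+n-i]≡1+n : i ℕ.+ suc (n ∸ i) ≡ suc n
    i+[1+n-i]≡1+n = trans (ℕP.+-suc i (n ∸ i)) (cong suc (ℕP.m+[n∸m]≡n i≤n))

-- The power series ring

-- ℚ[[u]] with u = t⁻¹; shift is multiplication by u.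
PowerSeries : Set
PowerSeries = ℕ → ℚ

infixl 6 _⊕_
infixl 7 _⊛_ _⊙_
infix  8 ⊖_

_⊕_ : PowerSeries → PowerSeries → PowerSeries
(f ⊕ g) n = f n + g n

⊖_ : PowerSeries → PowerSeries
(⊖ f) n = - f n

_⊙_ : ℚ → PowerSeries → PowerSeries
(c ⊙ f) n = c * f n

_⊛_ : PowerSeries → PowerSeries → PowerSeries
(f ⊛ g) n = convAux f g n n

𝟘 𝟙 : PowerSeries
𝟘 _       = 0ℚ
𝟙 zero    = 1ℚ
𝟙 (suc _) = 0ℚ

shift : PowerSeries → PowerSeries
shift f zero    = 0ℚ
shift f (suc n) = f n

⊛-as-sumTo : ∀ f g n → (f ⊛ g) n ≡ sumTo (λ j → f j * g (n ∸ j)) n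
⊛-as-sumTo f g n = go n
  where
  go : ∀ m → convAux f g n m ≡ sumTo (λ j → f j * g (n ∸ j)) m
  go zero    = refl
  go (suc m) = cong (_+ f (suc m) * g (n ∸ suc m)) (go m)

⊛-cong : ∀ {f f′ g g′} → f ≗ f′ → g ≗ g′ → f ⊛ g ≗ f′ ⊛ g′
⊛-cong {f} {f′} {g} {g′} f≗f′ g≗g′ n = begin
  (f ⊛ g) n                            ≡⟨ ⊛-as-sumTo f g n ⟩
  sumTo (λ j → f j * g (n ∸ j)) n      ≡⟨ sumTo-cong n (λ j _ → cong₂ _*_ (f≗f′ j) (g≗g′ (n ∸ j))) ⟩
  sumTo (λ j → f′ j * g′ (n ∸ j)) n    ≡⟨ ⊛-as-sumTo f′ g′ n ⟨
  (f′ ⊛ g′) n                          ∎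
  where open ≡-Reasoning

⊛-comm : ∀ f g → f ⊛ g ≗ g ⊛ f
⊛-comm f g n = begin
  (f ⊛ g) n                                          ≡⟨ ⊛-as-sumTo f g n ⟩
  sumTo (λ j → f j * g (n ∸ j)) n                    ≡⟨ sumTo-reverse _ n ⟩
  sumTo (λ j → f (n ∸ j) * g (n ∸ (n ∸ j))) n        ≡⟨ sumTo-cong n swap ⟩
  sumTo (λ j → g j * f (n ∸ j)) n                    ≡⟨ ⊛-as-sumTo g f n ⟨
  (g ⊛ f) n                                          ∎
  where
  open ≡-Reasoning
  swap : ∀ j → j ℕ.≤ n → f (n ∸ j) * g (n ∸ (n ∸ j)) ≡ g j * f (n ∸ j)
  swap j j≤n = trans (cong (λ k → f (n ∸ j) * g k) (ℕP.m∸[m∸n]≡n j≤n)) (*-comm (f (n ∸ j)) (g j))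

⊛-distribˡ-⊕ : ∀ f g h → f ⊛ (g ⊕ h) ≗ f ⊛ g ⊕ f ⊛ h
⊛-distribˡ-⊕ f g h n = begin
  (f ⊛ (g ⊕ h)) n                                                       ≡⟨ ⊛-as-sumTo f (g ⊕ h) n ⟩
  sumTo (λ j → f j * (g (n ∸ j) + h (n ∸ j))) n                         ≡⟨ sumTo-cong n (λ j _ → *-distribˡ-+ (f j) _ _) ⟩
  sumTo (λ j → f j * g (n ∸ j) + f j * h (n ∸ j)) n                     ≡⟨ sumTo-+ _ _ n ⟩
  sumTo (λ j → f j * g (n ∸ j)) n + sumTo (λ j → f j * h (n ∸ j)) n     ≡⟨ cong₂ _+_ (⊛-as-sumTo f g n) (⊛-as-sumTo f h n) ⟨
  (f ⊛ g ⊕ f ⊛ h) n                                                     ∎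
  where open ≡-Reasoning

⊛-assoc : ∀ f g h → (f ⊛ g) ⊛ h ≗ f ⊛ (g ⊛ h)
⊛-assoc f g h n = begin
    ((f ⊛ g) ⊛ h) n
  ≡⟨ ⊛-as-sumTo (f ⊛ g) h n ⟩
    sumTo (λ j → (f ⊛ g) j * h (n ∸ j)) n
  ≡⟨ sumTo-cong n (λ j _ → trans (cong (_* h (n ∸ j)) (⊛-as-sumTo f g j)) (sym (sumTo-*ʳ (h (n ∸ j)) _ j))) ⟩
    sumTo (λ j → sumTo (λ i → T i j) j) n
  ≡⟨ sumTo-triangle T n ⟩
    sumTo (λ i → sumTo (λ l → T i (i ℕ.+ l)) (n ∸ i)) n
  ≡⟨ sumTo-cong n (λ i _ → trans (sumTo-cong (n ∸ i) (λ l _ → reindex i l)) (sumTo-*ˡ (f i) _ (n ∸ i))) ⟩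
    sumTo (λ i → f i * sumTo (λ l → g l * h (n ∸ i ∸ l)) (n ∸ i)) n
  ≡⟨ sumTo-cong n (λ i _ → cong (f i *_) (⊛-as-sumTo g h (n ∸ i))) ⟨
    sumTo (λ i → f i * (g ⊛ h) (n ∸ i)) n
  ≡⟨ ⊛-as-sumTo f (g ⊛ h) n ⟨
    (f ⊛ (g ⊛ h)) n
  ∎
  where
  open ≡-Reasoning
  T : ℕ → ℕ → ℚ
  T i j = f i * g (j ∸ i) * h (n ∸ j)
  reindex : ∀ i l → T i (i ℕ.+ l) ≡ f i * (g l * h (n ∸ i ∸ l))
  reindex i l = trans (cong₂ (λ a b → f i * g a * h b) (ℕP.m+n∸m≡n i l) (sym (ℕP.∸-+-assoc n i l)))
                      (*-assoc (f i) (g l) _)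

𝟙-⊛ : ∀ f → 𝟙 ⊛ f ≗ f
𝟙-⊛ f zero    = *-identityˡ (f 0)
𝟙-⊛ f (suc n) = begin
  (𝟙 ⊛ f) (suc n)                                ≡⟨ ⊛-as-sumTo 𝟙 f (suc n) ⟩
  sumTo (λ j → 𝟙 j * f (suc n ∸ j)) (suc n)      ≡⟨ sumTo-unconsˡ _ n ⟩
  1ℚ * f (suc n) + sumTo (λ j → 0ℚ * f (n ∸ j)) n ≡⟨ cong₂ _+_ (*-identityˡ (f (suc n))) vanish ⟩
  f (suc n) + 0ℚ                                 ≡⟨ +-identityʳ _ ⟩
  f (suc n)                                      ∎
  where
  open ≡-Reasoning
  vanish : sumTo (λ j → 0ℚ * f (n ∸ j)) n ≡ 0ℚ
  vanish = trans (sumTo-cong n (λ j _ → *-zeroˡ (f (n ∸ j)))) (sumTo-zero n)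

𝟘-⊛ : ∀ f → 𝟘 ⊛ f ≗ 𝟘
𝟘-⊛ f n = trans (⊛-as-sumTo 𝟘 f n) (trans (sumTo-cong n (λ j _ → *-zeroˡ (f (n ∸ j)))) (sumTo-zero n))

shift-⊛ : ∀ f g → shift f ⊛ g ≗ shift (f ⊛ g)
shift-⊛ f g zero    = *-zeroˡ (g 0)
shift-⊛ f g (suc n) = begin
  (shift f ⊛ g) (suc n)                             ≡⟨ ⊛-as-sumTo (shift f) g (suc n) ⟩
  sumTo (λ j → shift f j * g (suc n ∸ j)) (suc n)   ≡⟨ sumTo-unconsˡ _ n ⟩
  0ℚ * g (suc n) + sumTo (λ j → f j * g (n ∸ j)) n  ≡⟨ cong (_+ sumTo (λ j → f j * g (n ∸ j)) n) (*-zeroˡ (g (suc n))) ⟩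
  0ℚ + sumTo (λ j → f j * g (n ∸ j)) n              ≡⟨ +-identityˡ _ ⟩
  sumTo (λ j → f j * g (n ∸ j)) n                   ≡⟨ ⊛-as-sumTo f g n ⟨
  shift (f ⊛ g) (suc n)                             ∎
  where open ≡-Reasoning

shift-cong : ∀ {f g} → f ≗ g → shift f ≗ shift g
shift-cong f≗g zero    = refl
shift-cong f≗g (suc n) = f≗g n

⊙-⊛ : ∀ c f g → (c ⊙ f) ⊛ g ≗ c ⊙ (f ⊛ g)
⊙-⊛ c f g n = begin
  ((c ⊙ f) ⊛ g) n                         ≡⟨ ⊛-as-sumTo (c ⊙ f) g n ⟩
  sumTo (λ j → c * f j * g (n ∸ j)) n     ≡⟨ sumTo-cong n (λ j _ → *-assoc c (f j) (g (n ∸ j))) ⟩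
  sumTo (λ j → c * (f j * g (n ∸ j))) n   ≡⟨ sumTo-*ˡ c _ n ⟩
  c * sumTo (λ j → f j * g (n ∸ j)) n     ≡⟨ cong (c *_) (⊛-as-sumTo f g n) ⟨
  c * (f ⊛ g) n                           ∎
  where open ≡-Reasoning

powerSeriesRing : CommutativeRing 0ℓ 0ℓ
powerSeriesRing = record
  { Carrier = PowerSeries
  ; _≈_ = _≗_
  ; _+_ = _⊕_
  ; _*_ = _⊛_
  ; -_  = ⊖_
  ; 0#  = 𝟘
  ; 1#  = 𝟙
  ; isCommutativeRing = record
    { isRing = record
      { +-isAbelianGroup = record
        { isGroup = record
          { isMonoid = record
            { isSemigroup = record
              { isMagma = record
                { isEquivalence = record { refl = λ _ → refl ; sym = λ e n → sym (e n) ; trans = λ e e′ n → trans (e n) (e′ n) }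
                ; ∙-cong = λ e e′ n → cong₂ _+_ (e n) (e′ n) }
              ; assoc = λ f g h n → +-assoc (f n) (g n) (h n) }
            ; identity = (λ f n → +-identityˡ (f n)) , (λ f n → +-identityʳ (f n)) }
          ; inverse = (λ f n → +-inverseˡ (f n)) , (λ f n → +-inverseʳ (f n))
          ; ⁻¹-cong = λ e n → cong -_ (e n) }
        ; comm = λ f g n → +-comm (f n) (g n) }
      ; *-cong = ⊛-cong
      ; *-assoc = ⊛-assoc
      ; *-identity = 𝟙-⊛ , (λ f n → trans (⊛-comm f 𝟙 n) (𝟙-⊛ f n))
      ; distrib = ⊛-distribˡ-⊕ , λ f g h n →
          trans (⊛-comm (g ⊕ h) f n) (trans (⊛-distribˡ-⊕ f g h n) (cong₂ _+_ (⊛-comm f g n) (⊛-comm f h n))) }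
    ; *-comm = ⊛-comm } }

open GroupProperties (CommutativeRing.+-group powerSeriesRing)
  using () renaming (x∙y⁻¹≈ε⇒x≈y to f⊖g≗𝟘⇒f≗g; x≈y⇒x∙y⁻¹≈ε to f≗g⇒f⊖g≗𝟘)

module ≗-Reasoning = SetoidReasoning (CommutativeRing.setoid powerSeriesRing)

≗-refl : ∀ {f : PowerSeries} → f ≗ f
≗-refl _ = refl

≗-sym : ∀ {f g : PowerSeries} → f ≗ g → g ≗ f
≗-sym f≗g n = sym (f≗g n)

≗-trans : ∀ {f g h : PowerSeries} → f ≗ g → g ≗ h → f ≗ h
≗-trans f≗g g≗h n = trans (f≗g n) (g≗h n)

⊕-cong : ∀ {f f′ g g′} → f ≗ f′ → g ≗ g′ → f ⊕ g ≗ f′ ⊕ g′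
⊕-cong f≗f′ g≗g′ n = cong₂ _+_ (f≗f′ n) (g≗g′ n)

⊕-congˡ : ∀ f {g g′} → g ≗ g′ → f ⊕ g ≗ f ⊕ g′
⊕-congˡ f g≗g′ n = cong (_+_ (f n)) (g≗g′ n)

⊕-congʳ : ∀ g {f f′} → f ≗ f′ → f ⊕ g ≗ f′ ⊕ g
⊕-congʳ g f≗f′ n = cong (_+ g n) (f≗f′ n)

⊛-congˡ : ∀ {f g g′} → g ≗ g′ → f ⊛ g ≗ f ⊛ g′
⊛-congˡ = ⊛-cong ≗-refl

⊛-congʳ : ∀ {f f′ g} → f ≗ f′ → f ⊛ g ≗ f′ ⊛ g
⊛-congʳ f≗f′ = ⊛-cong f≗f′ ≗-refl

⊖-cong : ∀ {f g} → f ≗ g → ⊖ f ≗ ⊖ g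
⊖-cong f≗g n = cong -_ (f≗g n)

⊛-zeroʳ : ∀ f → f ⊛ 𝟘 ≗ 𝟘
⊛-zeroʳ f = ≗-trans (⊛-comm f 𝟘) (𝟘-⊛ f)

ι : ℤ → PowerSeries
ι z = qz z ⊙ 𝟙

ι-⊛ : ∀ z f → ι z ⊛ f ≗ qz z ⊙ f
ι-⊛ z f n = trans (⊙-⊛ (qz z) 𝟙 f n) (cong (qz z *_) (𝟙-⊛ f n))

ι-homomorphism : ℤ.+-*-rawRing ACR.-Raw-AlmostCommutative⟶ ACR.fromCommutativeRing powerSeriesRing
ι-homomorphism = record
  { ⟦_⟧    = ι
  ; +-homo = λ i j n → trans (cong (_* 𝟙 n) (qz-homo-+ i j)) (*-distribʳ-+ (𝟙 n) (qz i) (qz j))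
  ; *-homo = λ i j n → trans (cong (_* 𝟙 n) (qz-homo-* i j))
                       (trans (*-assoc (qz i) (qz j) (𝟙 n)) (sym (ι-⊛ i (ι j) n)))
  ; -‿homo = λ i n → trans (cong (_* 𝟙 n) (qz-homo‿- i)) (sym (neg-distribˡ-* (qz i) (𝟙 n)))
  ; 0-homo = λ n → *-zeroˡ (𝟙 n)
  ; 1-homo = λ n → *-identityˡ (𝟙 n)
  }

ι-≟ : ∀ i j → Maybe (ι i ≗ ι j)
ι-≟ i j with i ℤP.≟ j
... | yes refl = just (λ _ → refl)
... | no _     = nothing

module PS-Solver = RingSolver ℤ.+-*-rawRing (ACR.fromCommutativeRing powerSeriesRing) ι-homomorphism ι-≟

-- u-adic limits

AgreeBelow : ℕ → PowerSeries → PowerSeries → Set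
AgreeBelow n f g = ∀ j → j ℕ.< n → f j ≡ g j

agreeBelow-weaken : ∀ {m n f g} → m ℕ.≤ n → AgreeBelow n f g → AgreeBelow m f g
agreeBelow-weaken m≤n f≈g j j<m = f≈g j (ℕP.<-≤-trans j<m m≤n)

agreeBelow-trans : ∀ {n f g h} → AgreeBelow n f g → AgreeBelow n g h → AgreeBelow n f h
agreeBelow-trans f≈g g≈h j j<n = trans (f≈g j j<n) (g≈h j j<n)

agreeBelow-extend : ∀ {n f g} → AgreeBelow n f g → f n ≡ g n → AgreeBelow (suc n) f g
agreeBelow-extend {n} f≈g fn≡gn j j<1+n with j ℕP.≟ n
... | yes refl = fn≡gn
... | no j≢n   = f≈g j (ℕP.≤∧≢⇒< (ℕP.≤-pred j<1+n) j≢n)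

coefficientwise-induction : ∀ {f g} → (∀ n → AgreeBelow n f g → f n ≡ g n) → f ≗ g
coefficientwise-induction {f} {g} step n = agree (suc n) n ℕP.≤-refl
  where
  agree : ∀ n → AgreeBelow n f g
  agree zero    _ ()
  agree (suc n) = agreeBelow-extend (agree n) (step n (agree n))

⊛-congʳ-below : ∀ {n f g} h → AgreeBelow (suc n) f g → (f ⊛ h) n ≡ (g ⊛ h) n
⊛-congʳ-below {n} {f} {g} h f≈g = begin
  (f ⊛ h) n                          ≡⟨ ⊛-as-sumTo f h n ⟩
  sumTo (λ j → f j * h (n ∸ j)) n    ≡⟨ sumTo-cong n (λ j j≤n → cong (_* h (n ∸ j)) (f≈g j (s≤s j≤n))) ⟩
  sumTo (λ j → g j * h (n ∸ j)) n    ≡⟨ ⊛-as-sumTo g h n ⟨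
  (g ⊛ h) n                          ∎
  where open ≡-Reasoning

⊛-firstDifference : ∀ {n f g} h → AgreeBelow n f g → (f ⊛ h) n ≡ (g ⊛ h) n + (f n - g n) * h 0
⊛-firstDifference {zero} {f} {g} h _ = rearrange (f 0) (g 0) (h 0)
  where
  rearrange : ∀ x y z → x * z ≡ y * z + (x - y) * z
  rearrange = solve-∀ ℚ-ring
⊛-firstDifference {suc m} {f} {g} h f≈g = begin
    (f ⊛ h) (suc m)
  ≡⟨ ⊛-as-sumTo f h (suc m) ⟩
    sumTo F m + f (suc m) * h (m ∸ m)
  ≡⟨ cong₂ (λ s k → s + f (suc m) * h k) (sumTo-cong m (λ j j≤m → cong (_* h (suc m ∸ j)) (f≈g j (s≤s j≤m)))) (ℕP.n∸n≡0 m) ⟩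
    sumTo G m + f (suc m) * h 0
  ≡⟨ rearrange (sumTo G m) (f (suc m)) (g (suc m)) (h 0) ⟩
    sumTo G m + g (suc m) * h 0 + (f (suc m) - g (suc m)) * h 0
  ≡⟨ cong (λ k → sumTo G m + g (suc m) * h k + (f (suc m) - g (suc m)) * h 0) (ℕP.n∸n≡0 m) ⟨
    sumTo G m + g (suc m) * h (m ∸ m) + (f (suc m) - g (suc m)) * h 0
  ≡⟨ cong (_+ (f (suc m) - g (suc m)) * h 0) (⊛-as-sumTo g h (suc m)) ⟨
    (g ⊛ h) (suc m) + (f (suc m) - g (suc m)) * h 0
  ∎
  where
  open ≡-Reasoning
  F G : ℕ → ℚ
  F j = f j * h (suc m ∸ j)
  G j = g j * h (suc m ∸ j)
  rearrange : ∀ s x y z → s + x * z ≡ s + y * z + (x - y) * z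
  rearrange = solve-∀ ℚ-ring

⊛-cancelˡ : ∀ {p f} → p 0 ≢ 0ℚ → p ⊛ f ≗ 𝟘 → f ≗ 𝟘
⊛-cancelˡ {p} {f} p₀≢0 pf≗0 = coefficientwise-induction step
  where
  step : ∀ n → AgreeBelow n f 𝟘 → f n ≡ 0ℚ
  step n f≈0 = trans (sym (+-identityʳ (f n))) (p*q≡0⇒q≡0 p₀≢0 (begin
    p 0 * (f n - 0ℚ)                ≡⟨ *-comm (p 0) _ ⟩
    (f n - 0ℚ) * p 0                ≡⟨ +-identityˡ _ ⟨
    0ℚ + (f n - 0ℚ) * p 0           ≡⟨ cong (_+ (f n - 0ℚ) * p 0) (𝟘-⊛ p n) ⟨
    (𝟘 ⊛ p) n + (f n - 0ℚ) * p 0    ≡⟨ ⊛-firstDifference p f≈0 ⟨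
    (f ⊛ p) n                       ≡⟨ ⊛-comm f p n ⟩
    (p ⊛ f) n                       ≡⟨ pf≗0 n ⟩
    0ℚ                              ∎))
    where open ≡-Reasoning

-- The n-th iterate of Φ is already correct below n, so the iterates converge u-adically to a fixed point.
module Contraction
  (P : ℚ → Set) (Φ : PowerSeries → PowerSeries)
  (Φ-preserves : ∀ f → P (f 0) → P (Φ f 0))
  (Φ-contracts : ∀ f g → P (f 0) → P (g 0) → ∀ n → AgreeBelow n f g → Φ f n ≡ Φ g n)
  (f₀ : PowerSeries) (Pf₀ : P (f₀ 0))
  where

  private
    iterate : ℕ → PowerSeries
    iterate zero    = f₀
    iterate (suc k) = Φ (iterate k)

    P-iterate : ∀ k → P (iterate k 0)
    P-iterate zero    = Pf₀
    P-iterate (suc k) = Φ-preserves (iterate k) (P-iterate k)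

    iterate-step : ∀ k → AgreeBelow k (iterate k) (iterate (suc k))
    iterate-step zero    j ()
    iterate-step (suc k) j j<k+1 = Φ-contracts (iterate k) (iterate (suc k)) (P-iterate k) (P-iterate (suc k)) j
      (agreeBelow-weaken (ℕP.≤-pred j<k+1) (iterate-step k))

    iterate-stable : ∀ m k → k ℕ.≤ m → AgreeBelow k (iterate k) (iterate m)
    iterate-stable zero    .zero z≤n j ()
    iterate-stable (suc m) k k≤m+1 with k ℕP.≤? m
    ... | yes k≤m = agreeBelow-trans (iterate-stable m k k≤m) (agreeBelow-weaken k≤m (iterate-step m))
    ... | no k≰m rewrite ℕP.≤-antisym k≤m+1 (ℕP.≰⇒> k≰m) = λ _ _ → refl

  fixedPoint : PowerSeries
  fixedPoint j = iterate (suc j) j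

  P-fixedPoint : P (fixedPoint 0)
  P-fixedPoint = P-iterate 1

  fixedPoint-fixed : Φ fixedPoint ≗ fixedPoint
  fixedPoint-fixed n = Φ-contracts fixedPoint (iterate n) P-fixedPoint (P-iterate n) n
    (λ j j<n → iterate-stable n (suc j) j<n j ℕP.≤-refl)

module Inverse (k : PowerSeries) (k₀≢0 : k 0 ≢ 0ℚ) where

  private
    instance _ = ≢-nonZero k₀≢0

    newton : PowerSeries → PowerSeries
    newton g = g ⊕ (- (1/ k 0)) ⊙ (k ⊛ g ⊕ ⊖ 𝟙)

    newton-contracts : ∀ g g′ → ⊤ → ⊤ → ∀ n → AgreeBelow n g g′ → newton g n ≡ newton g′ n
    newton-contracts g g′ _ _ n g≈g′ = begin
        g n + c * ((k ⊛ g) n + - 𝟙 n)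
      ≡⟨ cong (λ w → g n + c * (w + - 𝟙 n)) kg≡kg′+ ⟩
        g n + c * ((k ⊛ g′) n + (g n - g′ n) * k 0 + - 𝟙 n)
      ≡⟨ rearrange (g n) (g′ n) ((k ⊛ g′) n) (𝟙 n) (k 0) (1/ k 0) ⟩
        g′ n + c * ((k ⊛ g′) n + - 𝟙 n) + (g n - g′ n) * (1ℚ - (1/ k 0) * k 0)
      ≡⟨ cong (λ w → g′ n + c * ((k ⊛ g′) n + - 𝟙 n) + (g n - g′ n) * (1ℚ - w)) (*-inverseˡ (k 0)) ⟩
        g′ n + c * ((k ⊛ g′) n + - 𝟙 n) + (g n - g′ n) * (1ℚ - 1ℚ)
      ≡⟨ vanish (g′ n + c * ((k ⊛ g′) n + - 𝟙 n)) (g n - g′ n) ⟩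
        g′ n + c * ((k ⊛ g′) n + - 𝟙 n)
      ∎
      where
      open ≡-Reasoning
      c : ℚ
      c = - (1/ k 0)
      kg≡kg′+ : (k ⊛ g) n ≡ (k ⊛ g′) n + (g n - g′ n) * k 0
      kg≡kg′+ = trans (⊛-comm k g n) (trans (⊛-firstDifference k g≈g′) (cong (_+ (g n - g′ n) * k 0) (⊛-comm g′ k n)))
      rearrange : ∀ x y s d q i → x + (- i) * (s + (x - y) * q + - d) ≡ y + (- i) * (s + - d) + (x - y) * (1ℚ - i * q)
      rearrange = solve-∀ ℚ-ring
      vanish : ∀ a d → a + d * (1ℚ - 1ℚ) ≡ a
      vanish = solve-∀ ℚ-ring

    open Contraction (λ _ → ⊤) newton (λ _ _ → tt) newton-contracts 𝟙 tt

  k⁻¹ : PowerSeries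
  k⁻¹ = fixedPoint

  ⊛-inverseʳ : k ⊛ k⁻¹ ≗ 𝟙
  ⊛-inverseʳ n = p-q≡0⇒p≡q _ _ (begin
    e                                                   ≡⟨ rearrange (k 0) (1/ k 0) (k⁻¹ n) e ⟩
    - k 0 * ((k⁻¹ n + - (1/ k 0) * e) - k⁻¹ n) + (1ℚ - (1/ k 0) * k 0) * e
      ≡⟨ cong₂ (λ x y → - k 0 * (x - k⁻¹ n) + (1ℚ - y) * e) (fixedPoint-fixed n) (*-inverseˡ (k 0)) ⟩
    - k 0 * (k⁻¹ n - k⁻¹ n) + (1ℚ - 1ℚ) * e             ≡⟨ vanish (k 0) (k⁻¹ n) e ⟩
    0ℚ                                                  ∎)
    where
    open ≡-Reasoning
    e : ℚ
    e = (k ⊛ k⁻¹) n - 𝟙 n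
    rearrange : ∀ κ i x e → e ≡ - κ * ((x + - i * e) - x) + (1ℚ - i * κ) * e
    rearrange = solve-∀ ℚ-ring
    vanish : ∀ κ x e → - κ * (x - x) + (1ℚ - 1ℚ) * e ≡ 0ℚ
    vanish = solve-∀ ℚ-ring

  k⁻¹₀≢0 : k⁻¹ 0 ≢ 0ℚ
  k⁻¹₀≢0 k⁻¹₀≡0 = 1≢0 (begin
    1ℚ            ≡⟨ ⊛-inverseʳ 0 ⟨
    k 0 * k⁻¹ 0   ≡⟨ cong (k 0 *_) k⁻¹₀≡0 ⟩
    k 0 * 0ℚ      ≡⟨ *-zeroʳ (k 0) ⟩
    0ℚ            ∎)
    where open ≡-Reasoning

-- Laurent series as shifted power series

coeffAt : PowerSeries → ℤ → ℚ
coeffAt f (+ n)    = f n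
coeffAt f -[1+ _ ] = 0ℚ

-- x = t^N · f(t⁻¹), i.e. the coefficient of t^k in x is f (N − k).
record Represents (x : Laurent) (N : ℤ) (f : PowerSeries) : Set where
  constructor represents
  field coeff-≡ : ∀ k → coeff x k ≡ coeffAt f (N ℤ.- k)
open Represents public

private
  N-[N-k]≡k : ∀ N k → N ℤ.- (N ℤ.- k) ≡ k
  N-[N-k]≡k = ℤ-Tactic.solve-∀

  [N-k]+k≡N : ∀ N k → (N ℤ.- k) ℤ.+ k ≡ N
  [N-k]+k≡N = ℤ-Tactic.solve-∀

  1+N-k≡1+[N-k] : ∀ N k → (+ 1 ℤ.+ N) ℤ.- k ≡ + 1 ℤ.+ (N ℤ.- k)
  1+N-k≡1+[N-k] = ℤ-Tactic.solve-∀

  k+[N-k]≡N : ∀ k N → k ℤ.+ (N ℤ.- k) ≡ N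
  k+[N-k]≡N = ℤ-Tactic.solve-∀

  N+[1+m]≡1+[N+m] : ∀ N m → N ℤ.+ (+ 1 ℤ.+ m) ≡ + 1 ℤ.+ (N ℤ.+ m)
  N+[1+m]≡1+[N+m] = ℤ-Tactic.solve-∀

  N+[M-N]≡M+0 : ∀ N M → N ℤ.+ (M ℤ.- N) ≡ M ℤ.+ + 0
  N+[M-N]≡M+0 = ℤ-Tactic.solve-∀

  N+0≡M-[M-N] : ∀ N M → N ℤ.+ + 0 ≡ M ℤ.- (M ℤ.- N)
  N+0≡M-[M-N] = ℤ-Tactic.solve-∀

  interchange : ∀ a b c d → a ℤ.+ b ℤ.+ (c ℤ.+ d) ≡ (a ℤ.+ c) ℤ.+ (b ℤ.+ d)
  interchange = ℤ-Tactic.solve-∀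

  N-k≡-[1+r]⇒N<k : ∀ N k r → N ℤ.- k ≡ -[1+ r ] → N ℤ.< k
  N-k≡-[1+r]⇒N<k N k r eq = subst₂ ℤ._<_ (trans (cong (ℤ._+ k) (sym eq)) ([N-k]+k≡N N k)) (ℤP.+-identityˡ k)
                                 (ℤP.+-monoˡ-< k (-<+ {r} {0}))

lau-represents : ∀ N f → Represents (lau N f) N f
lau-represents N f = represents λ k → lemma k
  where
  lemma : ∀ k → coeff (lau N f) k ≡ coeffAt f (N ℤ.- k)
  lemma k with N ℤ.- k
  ... | + n      = refl
  ... | -[1+ _ ] = refl

coeffAt-cong : ∀ {f g} → f ≗ g → ∀ z → coeffAt f z ≡ coeffAt g z
coeffAt-cong f≗g (+ n)    = f≗g n
coeffAt-cong f≗g -[1+ _ ] = refl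

coeffAt-above : ∀ f N k → N ℤ.< k → coeffAt f (N ℤ.- k) ≡ 0ℚ
coeffAt-above f N k N<k with N ℤ.- k in eq
... | -[1+ _ ] = refl
... | + n      = contradiction k≤N (ℤP.<⇒≱ N<k)
  where
  k≤N : k ℤ.≤ N
  k≤N = subst (k ℤ.≤_) (trans (cong (ℤ._+_ k) (sym eq)) (k+[N-k]≡N k N)) (ℤP.i≤i+j k (+ n))

represents-cong : ∀ {x N f g} → f ≗ g → Represents x N f → Represents x N g
represents-cong {N = N} f≗g r = represents λ k → trans (coeff-≡ r k) (coeffAt-cong f≗g (N ℤ.- k))

represents-≈ : ∀ {x y N f} → x ≈ y → Represents y N f → Represents x N f
represents-≈ x≈y r = represents λ k → trans (x≈y k) (coeff-≡ r k)

represents⇒≈ : ∀ {x y N f} → Represents x N f → Represents y N f → x ≈ y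
represents⇒≈ rx ry k = trans (coeff-≡ rx k) (sym (coeff-≡ ry k))

represents-injective : ∀ {x N f g} → Represents x N f → Represents x N g → f ≗ g
represents-injective {x} {N} {f} {g} rf rg n = begin
  f n                                 ≡⟨ cong (coeffAt f) (N-[N-k]≡k N (+ n)) ⟨
  coeffAt f (N ℤ.- (N ℤ.- + n))       ≡⟨ coeff-≡ rf (N ℤ.- + n) ⟨
  coeff x (N ℤ.- + n)                 ≡⟨ coeff-≡ rg (N ℤ.- + n) ⟩
  coeffAt g (N ℤ.- (N ℤ.- + n))       ≡⟨ cong (coeffAt g) (N-[N-k]≡k N (+ n)) ⟩
  g n                                 ∎
  where open ≡-Reasoning

truncation-represents : ∀ y N → (∀ k → N ℤ.< k → coeff y k ≡ 0ℚ) → Represents y N (λ n → coeff y (N ℤ.- + n))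
truncation-represents y N vanish = represents lemma
  where
  lemma : ∀ k → coeff y k ≡ coeffAt (λ n → coeff y (N ℤ.- + n)) (N ℤ.- k)
  lemma k with N ℤ.- k in eq
  ... | + n      = cong (coeff y) (trans (sym (N-[N-k]≡k N k)) (cong (ℤ._-_ N) eq))
  ... | -[1+ r ] = vanish k (N-k≡-[1+r]⇒N<k N k r eq)

private
  coeffAt-𝟘 : ∀ z → coeffAt 𝟘 z ≡ 0ℚ
  coeffAt-𝟘 (+ _)    = refl
  coeffAt-𝟘 -[1+ _ ] = refl

  coeff-0L : ∀ k → coeff 0L k ≡ 0ℚ
  coeff-0L k with + 0 ℤ.- k
  ... | + zero   = refl
  ... | + suc _  = refl
  ... | -[1+ _ ] = refl

  coeffAt-shift : ∀ f z → coeffAt (shift f) (ℤ.suc z) ≡ coeffAt f z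
  coeffAt-shift f (+ n)        = refl
  coeffAt-shift f -[1+ zero ]  = refl
  coeffAt-shift f -[1+ suc _ ] = refl

0L-represents : ∀ N → Represents 0L N 𝟘
0L-represents N = represents λ k → trans (coeff-0L k) (sym (coeffAt-𝟘 (N ℤ.- k)))

represents-0L : ∀ {x N f} → Represents x N f → f ≗ 𝟘 → x ≈ 0L
represents-0L {N = N} r f≗0 = represents⇒≈ (represents-cong f≗0 r) (0L-represents N)

≈0L⇒represents-𝟘 : ∀ {x N f} → x ≈ 0L → Represents x N f → f ≗ 𝟘
≈0L⇒represents-𝟘 {N = N} x≈0 r = represents-injective r (represents-≈ x≈0 (0L-represents N))

tL-represents : Represents tL (+ 1) 𝟙
tL-represents = represents-cong (λ { zero → refl ; (suc _) → refl }) (lau-represents (+ 1) _)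

1L-represents : Represents 1L (+ 0) 𝟙
1L-represents = represents-cong (λ { zero → refl ; (suc _) → refl }) (lau-represents (+ 0) _)

represents-+L : ∀ {x y N f g} → Represents x N f → Represents y N g → Represents (x +L y) N (f ⊕ g)
represents-+L {x} {y} {N} {f} {g} rx ry = represents λ k →
  trans (coeff-+L k) (trans (cong₂ _+_ (coeff-≡ rx k) (coeff-≡ ry k)) (coeffAt-⊕ (N ℤ.- k)))
  where
  L : ℤ
  L = top x ℤ.⊔ top y
  coeffAt-⊕ : ∀ z → coeffAt f z + coeffAt g z ≡ coeffAt (f ⊕ g) z
  coeffAt-⊕ (+ n)    = refl
  coeffAt-⊕ -[1+ _ ] = +-identityˡ 0ℚ
  vanish : ∀ (z : Laurent) → top z ℤ.≤ L → ∀ k → L ℤ.< k → coeff z k ≡ 0ℚ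
  vanish z z≤L k L<k = trans (coeff-≡ (lau-represents (top z) (cf z)) k)
                             (coeffAt-above (cf z) (top z) k (ℤP.≤-<-trans z≤L L<k))
  coeff-+L : ∀ k → coeff (x +L y) k ≡ coeff x k + coeff y k
  coeff-+L k with L ℤ.- k in eq
  ... | + n      = cong (λ j → coeff x j + coeff y j) (trans (cong (ℤ._-_ L) (sym eq)) (N-[N-k]≡k L k))
  ... | -[1+ r ] = sym (trans (cong₂ _+_ (vanish x (ℤP.i≤i⊔j (top x) (top y)) k L<k)
                                         (vanish y (ℤP.i≤j⊔i (top x) (top y)) k L<k))
                              (+-identityˡ 0ℚ))
    where
    L<k : L ℤ.< k
    L<k = N-k≡-[1+r]⇒N<k L k r eq

represents-·L : ∀ {x N f} c → Represents x N f → Represents (c ·L x) N (c ⊙ f)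
represents-·L {lau M g} {N} {f} c r = represents λ k →
  trans (coeff-·L k) (trans (cong (c *_) (coeff-≡ r k)) (coeffAt-⊙ (N ℤ.- k)))
  where
  coeffAt-⊙ : ∀ z → c * coeffAt f z ≡ coeffAt (c ⊙ f) z
  coeffAt-⊙ (+ n)    = refl
  coeffAt-⊙ -[1+ _ ] = *-zeroʳ c
  coeff-·L : ∀ k → coeff (c ·L lau M g) k ≡ c * coeff (lau M g) k
  coeff-·L k with M ℤ.- k
  ... | + n      = refl
  ... | -[1+ _ ] = sym (*-zeroʳ c)

represents-shift : ∀ {x N f} → Represents x N f → Represents x (ℤ.suc N) (shift f)
represents-shift {N = N} {f} r = represents λ k →
  trans (coeff-≡ r k) (trans (sym (coeffAt-shift f (N ℤ.- k))) (cong (coeffAt (shift f)) (sym (1+N-k≡1+[N-k] N k))))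

represents-unshift : ∀ {x N f} → Represents x (ℤ.suc N) (shift f) → Represents x N f
represents-unshift {N = N} {f} r = represents λ k →
  trans (coeff-≡ r k) (trans (cong (coeffAt (shift f)) (1+N-k≡1+[N-k] N k)) (coeffAt-shift f (N ℤ.- k)))

shift^ : ℕ → PowerSeries → PowerSeries
shift^ zero    f = f
shift^ (suc m) f = shift (shift^ m f)

shift^-cong : ∀ m {f g} → f ≗ g → shift^ m f ≗ shift^ m g
shift^-cong zero    f≗g = f≗g
shift^-cong (suc m) f≗g = shift-cong (shift^-cong m f≗g)

shift^-+ : ∀ m n f → shift^ (m ℕ.+ n) f ≗ shift^ m (shift^ n f)
shift^-+ zero    n f _ = refl
shift^-+ (suc m) n f   = shift-cong (shift^-+ m n f)

shift^-⊛ : ∀ m f g → shift^ m f ⊛ g ≗ shift^ m (f ⊛ g)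
shift^-⊛ zero    f g _ = refl
shift^-⊛ (suc m) f g n = trans (shift-⊛ (shift^ m f) g n) (shift-cong (shift^-⊛ m f g) n)

shift^-⊛-shift^ : ∀ m n f g → shift^ m f ⊛ shift^ n g ≗ shift^ (m ℕ.+ n) (f ⊛ g)
shift^-⊛-shift^ m n f g k = begin
  (shift^ m f ⊛ shift^ n g) k     ≡⟨ shift^-⊛ m f (shift^ n g) k ⟩
  shift^ m (f ⊛ shift^ n g) k     ≡⟨ shift^-cong m commuted k ⟩
  shift^ m (shift^ n (f ⊛ g)) k   ≡⟨ shift^-+ m n (f ⊛ g) k ⟨
  shift^ (m ℕ.+ n) (f ⊛ g) k      ∎
  where
  open ≡-Reasoning
  commuted : f ⊛ shift^ n g ≗ shift^ n (f ⊛ g)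
  commuted j = trans (⊛-comm f (shift^ n g) j) (trans (shift^-⊛ n g f j) (shift^-cong n (⊛-comm g f) j))

represents-shift^ : ∀ m {x N f} → Represents x N f → Represents x (N ℤ.+ + m) (shift^ m f)
represents-shift^ zero    {N = N} r = subst (λ M → Represents _ M _) (sym (ℤP.+-identityʳ N)) r
represents-shift^ (suc m) {N = N} r =
  subst (λ M → Represents _ M _) (sym (N+[1+m]≡1+[N+m] N (+ m))) (represents-shift (represents-shift^ m r))

represents-unshift^ : ∀ m {x N f} → Represents x (N ℤ.+ + m) (shift^ m f) → Represents x N f
represents-unshift^ zero    {N = N} r = subst (λ M → Represents _ M _) (ℤP.+-identityʳ N) r
represents-unshift^ (suc m) {N = N} r =
  represents-unshift^ m (represents-unshift (subst (λ M → Represents _ M _) (N+[1+m]≡1+[N+m] N (+ m)) r))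

represents-commonTop : ∀ {x N f M g} → Represents x N f → Represents x M g →
  Σ ℕ λ m → Σ ℕ λ n → (N ℤ.+ + m ≡ M ℤ.+ + n) × (shift^ m f ≗ shift^ n g)
represents-commonTop {N = N} {M = M} rf rg with M ℤ.- N in eq
... | + m      = m , 0 , top≡ , represents-injective (represents-shift^ m rf) (subst (λ K → Represents _ K _) (sym top≡) (represents-shift^ 0 rg))
  where
  top≡ : N ℤ.+ + m ≡ M ℤ.+ + 0
  top≡ = trans (cong (ℤ._+_ N) (sym eq)) (N+[M-N]≡M+0 N M)
... | -[1+ n ] = 0 , suc n , top≡ , represents-injective (represents-shift^ 0 rf) (subst (λ K → Represents _ K _) (sym top≡) (represents-shift^ (suc n) rg))
  where
  top≡ : N ℤ.+ + 0 ≡ M ℤ.+ + suc n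
  top≡ = trans (N+0≡M-[M-N] N M) (cong (ℤ._-_ M) eq)

represents-*L : ∀ {x y N M f g} → Represents x N f → Represents y M g → Represents (x *L y) (N ℤ.+ M) (f ⊛ g)
represents-*L {lau N₀ f₀} {lau M₀ g₀} {N} {M} {f} {g} rx ry
  with represents-commonTop rx (lau-represents N₀ f₀) | represents-commonTop ry (lau-represents M₀ g₀)
... | m , m₀ , eN , f≗f₀ | n , n₀ , eM , g≗g₀ =
  represents-unshift^ (m ℕ.+ n) (subst (λ K → Represents _ K _) top≡
    (represents-cong padded (represents-shift^ (m₀ ℕ.+ n₀) (lau-represents (N₀ ℤ.+ M₀) (f₀ ⊛ g₀)))))
  where
  top≡ : N₀ ℤ.+ M₀ ℤ.+ + (m₀ ℕ.+ n₀) ≡ N ℤ.+ M ℤ.+ + (m ℕ.+ n)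
  top≡ = begin
    N₀ ℤ.+ M₀ ℤ.+ + (m₀ ℕ.+ n₀)         ≡⟨ cong (ℤ._+_ (N₀ ℤ.+ M₀)) (ℤP.pos-+ m₀ n₀) ⟩
    N₀ ℤ.+ M₀ ℤ.+ (+ m₀ ℤ.+ + n₀)       ≡⟨ interchange N₀ M₀ (+ m₀) (+ n₀) ⟩
    (N₀ ℤ.+ + m₀) ℤ.+ (M₀ ℤ.+ + n₀)     ≡⟨ cong₂ ℤ._+_ eN eM ⟨
    (N ℤ.+ + m) ℤ.+ (M ℤ.+ + n)         ≡⟨ interchange N (+ m) M (+ n) ⟩
    N ℤ.+ M ℤ.+ (+ m ℤ.+ + n)           ≡⟨ cong (ℤ._+_ (N ℤ.+ M)) (ℤP.pos-+ m n) ⟨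
    N ℤ.+ M ℤ.+ + (m ℕ.+ n)             ∎
    where open ≡-Reasoning
  padded : shift^ (m₀ ℕ.+ n₀) (f₀ ⊛ g₀) ≗ shift^ (m ℕ.+ n) (f ⊛ g)
  padded k = begin
    shift^ (m₀ ℕ.+ n₀) (f₀ ⊛ g₀) k      ≡⟨ shift^-⊛-shift^ m₀ n₀ f₀ g₀ k ⟨
    (shift^ m₀ f₀ ⊛ shift^ n₀ g₀) k     ≡⟨ ⊛-cong (sym ∘ f≗f₀) (sym ∘ g≗g₀) k ⟩
    (shift^ m f ⊛ shift^ n g) k         ≡⟨ shift^-⊛-shift^ m n f g k ⟩
    shift^ (m ℕ.+ n) (f ⊛ g) k          ∎
    where open ≡-Reasoning

-- The cubic and its root

private
  q3 q9 : ℚ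
  q3 = qz (+ 3)
  q9 = qz (+ 9)

u² : PowerSeries
u² = shift (shift 𝟙)

-- cubic (t^(1+m) · f(t⁻¹)) = t^(3+3m) · (cubicSeries m f)(t⁻¹); for m = 0 this is 3f³ − 3f² + 9u²f − u².
cubicSeries : ℕ → PowerSeries → PowerSeries
cubicSeries m f = q3 ⊙ (f ⊛ f ⊛ f) ⊕ (- 1ℚ) ⊙ (q3 ⊙ shift^ m (𝟙 ⊛ f ⊛ f))
                  ⊕ q9 ⊙ shift^ (2 ℕ.+ (m ℕ.+ m)) f ⊕ (- 1ℚ) ⊙ shift^ (2 ℕ.+ (m ℕ.+ (m ℕ.+ m))) 𝟙

cubic-represents : ∀ m {x f} → Represents x (+ suc m) f →
                   Represents (cubic x) (+ suc m ℤ.+ + suc m ℤ.+ + suc m) (cubicSeries m f)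
cubic-represents m r =
  represents-+L (represents-+L (represents-+L
    (represents-·L q3 (represents-*L (represents-*L r r) r))
    (represents-·L (- 1ℚ) (represents-·L q3 (retop (square (+ m)) (represents-shift^ m (represents-*L (represents-*L tL-represents r) r))))))
    (represents-·L q9 (retop (linear (+ m)) (represents-shift^ (2 ℕ.+ (m ℕ.+ m)) r))))
    (represents-·L (- 1ℚ) (retop (constant (+ m)) (represents-shift^ (2 ℕ.+ (m ℕ.+ (m ℕ.+ m))) tL-represents)))
  where
  retop : ∀ {x N M f} → N ≡ M → Represents x N f → Represents x M f
  retop refl r = r
  square : ∀ (M : ℤ) → + 1 ℤ.+ (+ 1 ℤ.+ M) ℤ.+ (+ 1 ℤ.+ M) ℤ.+ M ≡ (+ 1 ℤ.+ M) ℤ.+ (+ 1 ℤ.+ M) ℤ.+ (+ 1 ℤ.+ M)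
  square = ℤ-Tactic.solve-∀
  linear : ∀ (M : ℤ) → (+ 1 ℤ.+ M) ℤ.+ (+ 2 ℤ.+ (M ℤ.+ M)) ≡ (+ 1 ℤ.+ M) ℤ.+ (+ 1 ℤ.+ M) ℤ.+ (+ 1 ℤ.+ M)
  linear = ℤ-Tactic.solve-∀
  constant : ∀ (M : ℤ) → + 1 ℤ.+ (+ 2 ℤ.+ (M ℤ.+ (M ℤ.+ M))) ≡ (+ 1 ℤ.+ M) ℤ.+ (+ 1 ℤ.+ M) ℤ.+ (+ 1 ℤ.+ M)
  constant = ℤ-Tactic.solve-∀

square-agreeBelow : ∀ {n f g} → AgreeBelow n f g → AgreeBelow n (f ⊛ f) (g ⊛ g)
square-agreeBelow {f = f} {g} f≈g j j<n = begin
  (f ⊛ f) j   ≡⟨ ⊛-congʳ-below f (agreeBelow-weaken j<n f≈g) ⟩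
  (g ⊛ f) j   ≡⟨ ⊛-comm g f j ⟩
  (f ⊛ g) j   ≡⟨ ⊛-congʳ-below g (agreeBelow-weaken j<n f≈g) ⟩
  (g ⊛ g) j   ∎
  where open ≡-Reasoning

square-firstDifference : ∀ {n f g} → AgreeBelow n f g → (f ⊛ f) n ≡ (g ⊛ g) n + (f n - g n) * (f 0 + g 0)
square-firstDifference {n} {f} {g} f≈g = begin
    (f ⊛ f) n
  ≡⟨ ⊛-firstDifference f f≈g ⟩
    (g ⊛ f) n + (f n - g n) * f 0
  ≡⟨ cong (_+ (f n - g n) * f 0) (trans (⊛-comm g f n) (⊛-firstDifference g f≈g)) ⟩
    (g ⊛ g) n + (f n - g n) * g 0 + (f n - g n) * f 0
  ≡⟨ collect ((g ⊛ g) n) (f n - g n) (f 0) (g 0) ⟩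
    (g ⊛ g) n + (f n - g n) * (f 0 + g 0)
  ∎
  where
  open ≡-Reasoning
  collect : ∀ s d a b → s + d * b + d * a ≡ s + d * (a + b)
  collect = solve-∀ ℚ-ring

cube-firstDifference : ∀ {n f g} → f 0 ≡ 1ℚ → g 0 ≡ 1ℚ → AgreeBelow n f g →
                       (f ⊛ f ⊛ f) n ≡ (g ⊛ g ⊛ g) n + q3 * (f n - g n)
cube-firstDifference {n} {f} {g} f₀≡1 g₀≡1 f≈g = begin
    (f ⊛ f ⊛ f) n
  ≡⟨ ⊛-firstDifference f (square-agreeBelow f≈g) ⟩
    (g ⊛ g ⊛ f) n + ((f ⊛ f) n - (g ⊛ g) n) * f 0
  ≡⟨ cong₂ (λ a b → a + (b - (g ⊛ g) n) * f 0) ggf≡ (square-firstDifference f≈g) ⟩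
    (g ⊛ g ⊛ g) n + (f n - g n) * (g 0 * g 0) + ((g ⊛ g) n + (f n - g n) * (f 0 + g 0) - (g ⊛ g) n) * f 0
  ≡⟨ cong₂ (λ a b → (g ⊛ g ⊛ g) n + (f n - g n) * (b * b) + ((g ⊛ g) n + (f n - g n) * (a + b) - (g ⊛ g) n) * a) f₀≡1 g₀≡1 ⟩
    (g ⊛ g ⊛ g) n + (f n - g n) * (1ℚ * 1ℚ) + ((g ⊛ g) n + (f n - g n) * (1ℚ + 1ℚ) - (g ⊛ g) n) * 1ℚ
  ≡⟨ collect ((g ⊛ g ⊛ g) n) ((g ⊛ g) n) (f n - g n) ⟩
    (g ⊛ g ⊛ g) n + q3 * (f n - g n)
  ∎
  where
  open ≡-Reasoning
  ggf≡ : (g ⊛ g ⊛ f) n ≡ (g ⊛ g ⊛ g) n + (f n - g n) * (g 0 * g 0)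
  ggf≡ = trans (⊛-comm (g ⊛ g) f n) (trans (⊛-firstDifference (g ⊛ g) f≈g)
               (cong (_+ (f n - g n) * (g 0 * g 0)) (⊛-comm g (g ⊛ g) n)))
  collect : ∀ s t d → s + d * (1ℚ * 1ℚ) + (t + d * (1ℚ + 1ℚ) - t) * 1ℚ ≡ s + q3 * d
  collect = solve-∀ ℚ-ring

-- Near g₀ = 1 the linear part of cubicSeries 0 is 9g² − 6g = 3.
cubicSeries-firstDifference : ∀ {n f g} → f 0 ≡ 1ℚ → g 0 ≡ 1ℚ → AgreeBelow n f g →
                              cubicSeries 0 f n ≡ cubicSeries 0 g n + q3 * (f n - g n)
cubicSeries-firstDifference {n} {f} {g} f₀≡1 g₀≡1 f≈g = begin
    q3 * (f ⊛ f ⊛ f) n + - 1ℚ * (q3 * (𝟙 ⊛ f ⊛ f) n) + q9 * shift (shift f) n + - 1ℚ * u² n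
  ≡⟨ cong₃ (λ a b c → q3 * a + - 1ℚ * (q3 * b) + q9 * c + - 1ℚ * u² n)
           (cube-firstDifference f₀≡1 g₀≡1 f≈g) (trans (𝟙ff n) (square-firstDifference f≈g)) (shift²-agree n f≈g) ⟩
    q3 * ((g ⊛ g ⊛ g) n + q3 * d) + - 1ℚ * (q3 * ((g ⊛ g) n + d * (f 0 + g 0))) + q9 * shift (shift g) n + - 1ℚ * u² n
  ≡⟨ cong₂ (λ a b → q3 * ((g ⊛ g ⊛ g) n + q3 * d) + - 1ℚ * (q3 * ((g ⊛ g) n + d * (a + b)))
                     + q9 * shift (shift g) n + - 1ℚ * u² n) f₀≡1 g₀≡1 ⟩
    q3 * ((g ⊛ g ⊛ g) n + q3 * d) + - 1ℚ * (q3 * ((g ⊛ g) n + d * (1ℚ + 1ℚ))) + q9 * shift (shift g) n + - 1ℚ * u² n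
  ≡⟨ collect ((g ⊛ g ⊛ g) n) ((g ⊛ g) n) d (shift (shift g) n) (u² n) ⟩
    q3 * (g ⊛ g ⊛ g) n + - 1ℚ * (q3 * (g ⊛ g) n) + q9 * shift (shift g) n + - 1ℚ * u² n + q3 * d
  ≡⟨ cong (λ a → q3 * (g ⊛ g ⊛ g) n + - 1ℚ * (q3 * a) + q9 * shift (shift g) n + - 1ℚ * u² n + q3 * d) (𝟙ff n) ⟨
    cubicSeries 0 g n + q3 * d
  ∎
  where
  open ≡-Reasoning
  d : ℚ
  d = f n - g n
  cong₃ : ∀ {a b c a′ b′ c′ : ℚ} (F : ℚ → ℚ → ℚ → ℚ) → a ≡ a′ → b ≡ b′ → c ≡ c′ → F a b c ≡ F a′ b′ c′
  cong₃ F refl refl refl = refl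
  𝟙ff : ∀ {h} → 𝟙 ⊛ h ⊛ h ≗ h ⊛ h
  𝟙ff {h} = ⊛-cong (𝟙-⊛ h) (λ _ → refl)
  shift²-agree : ∀ n → AgreeBelow n f g → shift (shift f) n ≡ shift (shift g) n
  shift²-agree zero          _   = refl
  shift²-agree (suc zero)    _   = refl
  shift²-agree (suc (suc m)) f≈g = f≈g m (ℕP.n≤1+n (suc m))
  collect : ∀ c t d s e → q3 * (c + q3 * d) + - 1ℚ * (q3 * (t + d * (1ℚ + 1ℚ))) + q9 * s + - 1ℚ * e
                          ≡ q3 * c + - 1ℚ * (q3 * t) + q9 * s + - 1ℚ * e + q3 * d
  collect = solve-∀ ℚ-ring

private
  -1/3 : ℚ
  -1/3 = - (+ 1 ℚ./ 3)

  -- Newton's method for cubicSeries 0 with the derivative frozen at its value 3 at g₀ = 1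
  newton : PowerSeries → PowerSeries
  newton f = f ⊕ -1/3 ⊙ cubicSeries 0 f

  newton-preserves : ∀ f → f 0 ≡ 1ℚ → newton f 0 ≡ 1ℚ
  newton-preserves f f₀≡1 rewrite f₀≡1 = refl

  newton-contracts : ∀ f g → f 0 ≡ 1ℚ → g 0 ≡ 1ℚ → ∀ n → AgreeBelow n f g → newton f n ≡ newton g n
  newton-contracts f g f₀≡1 g₀≡1 n f≈g = begin
    f n + -1/3 * cubicSeries 0 f n                     ≡⟨ cong (λ e → f n + -1/3 * e) (cubicSeries-firstDifference f₀≡1 g₀≡1 f≈g) ⟩
    f n + -1/3 * (cubicSeries 0 g n + q3 * (f n - g n)) ≡⟨ cancel (f n) (g n) (cubicSeries 0 g n) ⟩
    g n + -1/3 * cubicSeries 0 g n                     ∎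
    where
    open ≡-Reasoning
    cancel : ∀ x y e → x + -1/3 * (e + q3 * (x - y)) ≡ y + -1/3 * e
    cancel = solve-∀ ℚ-ring

  module Root = Contraction (_≡ 1ℚ) newton newton-preserves newton-contracts 𝟙 refl

cubicRoot : PowerSeries
cubicRoot = Root.fixedPoint

cubicRoot₀≡1 : cubicRoot 0 ≡ 1ℚ
cubicRoot₀≡1 = Root.P-fixedPoint

cubicSeries-cubicRoot≗𝟘 : cubicSeries 0 cubicRoot ≗ 𝟘
cubicSeries-cubicRoot≗𝟘 n = begin
  cubicSeries 0 cubicRoot n                                               ≡⟨ isolate (cubicRoot n) (cubicSeries 0 cubicRoot n) ⟩
  - q3 * ((cubicRoot n + -1/3 * cubicSeries 0 cubicRoot n) - cubicRoot n) ≡⟨ cong (λ x → - q3 * (x - cubicRoot n)) (Root.fixedPoint-fixed n) ⟩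
  - q3 * (cubicRoot n - cubicRoot n)                                      ≡⟨ vanish (cubicRoot n) ⟩
  0ℚ                                                                      ∎
  where
  open ≡-Reasoning
  isolate : ∀ x e → e ≡ - q3 * ((x + -1/3 * e) - x)
  isolate = solve-∀ ℚ-ring
  vanish : ∀ x → - q3 * (x - x) ≡ 0ℚ
  vanish = solve-∀ ℚ-ring

cubicRoot-unique : ∀ g → cubicSeries 0 g ≗ 𝟘 → g 0 ≡ 1ℚ → g ≗ cubicRoot
cubicRoot-unique g g-root g₀≡1 = coefficientwise-induction λ n g≈root →
  p-q≡0⇒p≡q _ _ (p*q≡0⇒q≡0 {q3} (λ ()) (begin
    q3 * (g n - cubicRoot n)                              ≡⟨ +-identityˡ _ ⟨
    0ℚ + q3 * (g n - cubicRoot n)                         ≡⟨ cong (_+ q3 * (g n - cubicRoot n)) (cubicSeries-cubicRoot≗𝟘 n) ⟨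
    cubicSeries 0 cubicRoot n + q3 * (g n - cubicRoot n)    ≡⟨ cubicSeries-firstDifference g₀≡1 cubicRoot₀≡1 g≈root ⟨
    cubicSeries 0 g n                                       ≡⟨ g-root n ⟩
    0ℚ                                                    ∎))
  where open ≡-Reasoning

-- The Riccati equation

-- the Euler operator u d/du
θ : PowerSeries → PowerSeries
θ f n = qz (+ n) * f n

θ-cong : ∀ {f g} → f ≗ g → θ f ≗ θ g
θ-cong f≗g n = cong (qz (+ n) *_) (f≗g n)

θ-⊕ : ∀ f g → θ (f ⊕ g) ≗ θ f ⊕ θ g
θ-⊕ f g n = *-distribˡ-+ (qz (+ n)) (f n) (g n)

θ-⊖ : ∀ f → θ (⊖ f) ≗ ⊖ θ f
θ-⊖ f n = sym (neg-distribʳ-* (qz (+ n)) (f n))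

θ-𝟘 : θ 𝟘 ≗ 𝟘
θ-𝟘 n = *-zeroʳ (qz (+ n))

θ-ι : ∀ z → θ (ι z) ≗ 𝟘
θ-ι z zero    = *-zeroˡ (ι z 0)
θ-ι z (suc n) = trans (cong (qz (+ suc n) *_) (*-zeroʳ (qz z))) (*-zeroʳ (qz (+ suc n)))

θ-u² : θ u² ≗ ι (+ 2) ⊛ u²
θ-u² n = trans (pointwise n) (sym (ι-⊛ (+ 2) u² n))
  where
  pointwise : ∀ n → θ u² n ≡ qz (+ 2) * u² n
  pointwise 0               = refl
  pointwise 1               = refl
  pointwise 2               = refl
  pointwise (suc (suc (suc m))) = trans (*-zeroʳ (qz (+ suc (suc (suc m))))) (sym (*-zeroʳ (qz (+ 2))))

θ-⊛ : ∀ f g → θ (f ⊛ g) ≗ θ f ⊛ g ⊕ f ⊛ θ g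
θ-⊛ f g n = begin
  qz (+ n) * (f ⊛ g) n                                                ≡⟨ cong (qz (+ n) *_) (⊛-as-sumTo f g n) ⟩
  qz (+ n) * sumTo (λ j → f j * g (n ∸ j)) n                          ≡⟨ sumTo-*ˡ (qz (+ n)) _ n ⟨
  sumTo (λ j → qz (+ n) * (f j * g (n ∸ j))) n                        ≡⟨ sumTo-cong n leibniz ⟩
  sumTo (λ j → θ f j * g (n ∸ j) + f j * θ g (n ∸ j)) n               ≡⟨ sumTo-+ _ _ n ⟩
  sumTo (λ j → θ f j * g (n ∸ j)) n + sumTo (λ j → f j * θ g (n ∸ j)) n ≡⟨ cong₂ _+_ (⊛-as-sumTo (θ f) g n) (⊛-as-sumTo f (θ g) n) ⟨
  (θ f ⊛ g ⊕ f ⊛ θ g) n                                               ∎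
  where
  open ≡-Reasoning
  leibniz : ∀ j → j ℕ.≤ n → qz (+ n) * (f j * g (n ∸ j)) ≡ θ f j * g (n ∸ j) + f j * θ g (n ∸ j)
  leibniz j j≤n = begin
    qz (+ n) * (f j * g (n ∸ j))                                  ≡⟨ cong (λ k → qz (+ k) * (f j * g (n ∸ j))) (ℕP.m+[n∸m]≡n j≤n) ⟨
    qz (+ j ℤ.+ + (n ∸ j)) * (f j * g (n ∸ j))                    ≡⟨ cong (_* (f j * g (n ∸ j))) (qz-homo-+ (+ j) (+ (n ∸ j))) ⟩
    (qz (+ j) + qz (+ (n ∸ j))) * (f j * g (n ∸ j))               ≡⟨ distribute (qz (+ j)) (qz (+ (n ∸ j))) (f j) (g (n ∸ j)) ⟩
    qz (+ j) * f j * g (n ∸ j) + f j * (qz (+ (n ∸ j)) * g (n ∸ j)) ∎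
    where
    distribute : ∀ a b x y → (a + b) * (x * y) ≡ a * x * y + x * (b * y)
    distribute = solve-∀ ℚ-ring

θ-ι⊛ : ∀ z f → θ (ι z ⊛ f) ≗ ι z ⊛ θ f
θ-ι⊛ z f n = begin
  θ (ι z ⊛ f) n                     ≡⟨ θ-⊛ (ι z) f n ⟩
  (θ (ι z) ⊛ f) n + (ι z ⊛ θ f) n   ≡⟨ cong (_+ (ι z ⊛ θ f) n) (trans (⊛-cong (θ-ι z) (λ _ → refl) n) (𝟘-⊛ f n)) ⟩
  0ℚ + (ι z ⊛ θ f) n                ≡⟨ +-identityˡ _ ⟩
  (ι z ⊛ θ f) n                     ∎
  where open ≡-Reasoning

shift²≗u²⊛ : ∀ f → shift (shift f) ≗ u² ⊛ f
shift²≗u²⊛ f = ≗-sym (≗-trans (shift-⊛ (shift 𝟙) f) (shift-cong (≗-trans (shift-⊛ 𝟙 f) (shift-cong (𝟙-⊛ f)))))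

1-9u² : PowerSeries
1-9u² = ι (+ 1) ⊕ ⊖ (ι (+ 9) ⊛ u²)

-- For x = t·g(t⁻¹) one has dx/dt = g − θ g, so this is the Riccati equation
-- e (t² − 9) x′ = p x² + q t x + r divided by t².
Riccati : (e p q r g : PowerSeries) → Set
Riccati e p q r g = e ⊛ 1-9u² ⊛ (g ⊕ ⊖ θ g) ≗ p ⊛ (g ⊛ g) ⊕ q ⊛ g ⊕ r ⊛ u²

cubicPolynomial : PowerSeries → PowerSeries
cubicPolynomial f = ι (+ 3) ⊛ (f ⊛ f ⊛ f) ⊕ ⊖ (ι (+ 3) ⊛ (f ⊛ f)) ⊕ ι (+ 9) ⊛ (u² ⊛ f) ⊕ ⊖ u²

θcubicPolynomial : PowerSeries → PowerSeries
θcubicPolynomial f =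
  ι (+ 3) ⊛ ((θ f ⊛ f ⊕ f ⊛ θ f) ⊛ f ⊕ f ⊛ f ⊛ θ f) ⊕ ⊖ (ι (+ 3) ⊛ (θ f ⊛ f ⊕ f ⊛ θ f))
  ⊕ ι (+ 9) ⊛ (ι (+ 2) ⊛ u² ⊛ f ⊕ u² ⊛ θ f) ⊕ ⊖ (ι (+ 2) ⊛ u²)

cubicSeries≗cubicPolynomial : ∀ f → cubicSeries 0 f ≗ cubicPolynomial f
cubicSeries≗cubicPolynomial f =
  ⊕-cong (⊕-cong (⊕-cong (≗-sym (ι-⊛ (+ 3) (f ⊛ f ⊛ f)))
                         (≗-trans (minus _) (⊖-cong (≗-trans (≗-sym (ι-⊛ (+ 3) _)) (⊛-congˡ 𝟙ff)))))
                 (≗-trans (≗-sym (ι-⊛ (+ 9) _)) (⊛-congˡ (shift²≗u²⊛ f))))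
         (minus u²)
  where
  minus : ∀ h → (- 1ℚ) ⊙ h ≗ ⊖ h
  minus h n = trans (sym (neg-distribˡ-* 1ℚ (h n))) (cong -_ (*-identityˡ (h n)))
  𝟙ff : 𝟙 ⊛ f ⊛ f ≗ f ⊛ f
  𝟙ff = ⊛-congʳ (𝟙-⊛ f)

θ-cubicPolynomial : ∀ f → θ (cubicPolynomial f) ≗ θcubicPolynomial f
θ-cubicPolynomial f =
  ≗-trans (θ-⊕ _ _) (⊕-cong (≗-trans (θ-⊕ _ _) (⊕-cong (≗-trans (θ-⊕ _ _) (⊕-cong cube square)) linear)) constant)
  where
  cube : θ (ι (+ 3) ⊛ (f ⊛ f ⊛ f)) ≗ ι (+ 3) ⊛ ((θ f ⊛ f ⊕ f ⊛ θ f) ⊛ f ⊕ f ⊛ f ⊛ θ f)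
  cube = ≗-trans (θ-ι⊛ (+ 3) (f ⊛ f ⊛ f)) (⊛-congˡ
           (≗-trans (θ-⊛ (f ⊛ f) f) (⊕-congʳ (f ⊛ f ⊛ θ f) (⊛-congʳ (θ-⊛ f f)))))
  square : θ (⊖ (ι (+ 3) ⊛ (f ⊛ f))) ≗ ⊖ (ι (+ 3) ⊛ (θ f ⊛ f ⊕ f ⊛ θ f))
  square = ≗-trans (θ-⊖ _) (⊖-cong (≗-trans (θ-ι⊛ (+ 3) (f ⊛ f)) (⊛-congˡ (θ-⊛ f f))))
  linear : θ (ι (+ 9) ⊛ (u² ⊛ f)) ≗ ι (+ 9) ⊛ (ι (+ 2) ⊛ u² ⊛ f ⊕ u² ⊛ θ f)
  linear = ≗-trans (θ-ι⊛ (+ 9) _) (⊛-congˡ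
             (≗-trans (θ-⊛ u² f) (⊕-congʳ (u² ⊛ θ f) (⊛-congʳ θ-u²))))
  constant : θ (⊖ u²) ≗ ⊖ (ι (+ 2) ⊛ u²)
  constant = ≗-trans (θ-⊖ u²) (⊖-cong θ-u²)

-- Differentiating the cubic, x′·(9x² − 6tx + 9) = 3x² + 1; eliminating x³ with the cubic
-- itself leaves (t² − 9)·x′ = x² − 1. The multipliers below record that elimination.
cubicRoot-riccati : Riccati (ι (+ 1)) (ι (+ 1)) (ι (+ 0)) (ι -[1+ 0 ]) cubicRoot
cubicRoot-riccati = f⊖g≗𝟘⇒f≗g _ _ (⊛-cancelˡ {p = ∂cubic} ∂cubic₀≢0 (≗-trans elimination vanish))
  where
  open PS-Solver
  X ∂cubic multiplier : PowerSeries
  X = cubicRoot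
  ∂cubic = ι (+ 9) ⊛ X ⊛ X ⊕ ⊖ (ι (+ 6) ⊛ X) ⊕ ι (+ 9) ⊛ u²
  multiplier = ι (+ 3) ⊛ 1-9u² ⊕ ⊖ (ι (+ 3) ⊛ X) ⊕ ⊖ ι (+ 1)

  elimination : ∂cubic ⊛ (ι (+ 1) ⊛ 1-9u² ⊛ (X ⊕ ⊖ θ X) ⊕ ⊖ (ι (+ 1) ⊛ (X ⊛ X) ⊕ ι (+ 0) ⊛ X ⊕ ι -[1+ 0 ] ⊛ u²))
                ≗ ⊖ (1-9u² ⊛ θcubicPolynomial X) ⊕ multiplier ⊛ cubicPolynomial X
  elimination = solve 3 (λ X Y S →
    (con (+ 9) :* X :* X :+ :- (con (+ 6) :* X) :+ con (+ 9) :* S) :*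
      (con (+ 1) :* (con (+ 1) :+ :- (con (+ 9) :* S)) :* (X :+ :- Y)
       :+ :- (con (+ 1) :* (X :* X) :+ con (+ 0) :* X :+ con -[1+ 0 ] :* S))
    := :- ((con (+ 1) :+ :- (con (+ 9) :* S)) :*
           (con (+ 3) :* ((Y :* X :+ X :* Y) :* X :+ X :* X :* Y) :+ :- (con (+ 3) :* (Y :* X :+ X :* Y))
            :+ con (+ 9) :* (con (+ 2) :* S :* X :+ S :* Y) :+ :- (con (+ 2) :* S)))
       :+ (con (+ 3) :* (con (+ 1) :+ :- (con (+ 9) :* S)) :+ :- (con (+ 3) :* X) :+ :- con (+ 1)) :*
          (con (+ 3) :* (X :* X :* X) :+ :- (con (+ 3) :* (X :* X)) :+ con (+ 9) :* (S :* X) :+ :- S))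
    (λ _ → refl) X (θ X) u²

  cubicPolynomial≗𝟘 : cubicPolynomial X ≗ 𝟘
  cubicPolynomial≗𝟘 = ≗-trans (≗-sym (cubicSeries≗cubicPolynomial X)) cubicSeries-cubicRoot≗𝟘

  θcubicPolynomial≗𝟘 : θcubicPolynomial X ≗ 𝟘
  θcubicPolynomial≗𝟘 = ≗-trans (≗-sym (θ-cubicPolynomial X)) (≗-trans (θ-cong cubicPolynomial≗𝟘) θ-𝟘)

  vanish : ⊖ (1-9u² ⊛ θcubicPolynomial X) ⊕ multiplier ⊛ cubicPolynomial X ≗ 𝟘
  vanish = ≗-trans (⊕-cong (⊖-cong (≗-trans (⊛-congˡ θcubicPolynomial≗𝟘) (⊛-zeroʳ 1-9u²)))
                           (≗-trans (⊛-congˡ cubicPolynomial≗𝟘) (⊛-zeroʳ multiplier)))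
                   (λ _ → refl)

  ∂cubic₀≢0 : ∂cubic 0 ≢ 0ℚ
  ∂cubic₀≢0 e = contradiction (trans (cong (λ x → qz (+ 9) * 1ℚ * x * x + - (qz (+ 6) * 1ℚ * x) + qz (+ 9) * 1ℚ * 0ℚ)
                                           (sym cubicRoot₀≡1)) e) (λ ())

combination₂≗𝟘 : ∀ {x c₁ d₁ c₂ d₂} → x ≗ c₁ ⊛ d₁ ⊕ c₂ ⊛ d₂ → d₁ ≗ 𝟘 → d₂ ≗ 𝟘 → x ≗ 𝟘
combination₂≗𝟘 {c₁ = c₁} {c₂ = c₂} x≗ d₁≗0 d₂≗0 =
  ≗-trans x≗ (≗-trans (⊕-cong (≗-trans (⊛-congˡ d₁≗0) (⊛-zeroʳ c₁))
                              (≗-trans (⊛-congˡ d₂≗0) (⊛-zeroʳ c₂)))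
                      (λ _ → +-identityˡ 0ℚ))

combination₃≗𝟘 : ∀ {x c₁ d₁ c₂ d₂ c₃ d₃} → x ≗ c₁ ⊛ d₁ ⊕ c₂ ⊛ d₂ ⊕ c₃ ⊛ d₃ →
                 d₁ ≗ 𝟘 → d₂ ≗ 𝟘 → d₃ ≗ 𝟘 → x ≗ 𝟘
combination₃≗𝟘 {c₃ = c₃} x≗ d₁≗0 d₂≗0 d₃≗0 =
  ≗-trans x≗ (≗-trans (⊕-cong (combination₂≗𝟘 ≗-refl d₁≗0 d₂≗0)
                              (≗-trans (⊛-congˡ d₃≗0) (⊛-zeroʳ c₃)))
                      (λ _ → +-identityˡ 0ℚ))

u²⊛-cancel : ∀ {f} → u² ⊛ f ≗ 𝟘 → f ≗ 𝟘
u²⊛-cancel {f} u²f≗0 n = trans (shift²≗u²⊛ f (suc (suc n))) (u²f≗0 (suc (suc n)))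

Riccati-cong : ∀ {e p q r e′ p′ q′ r′ g} → e ≗ e′ → p ≗ p′ → q ≗ q′ → r ≗ r′ →
               Riccati e p q r g → Riccati e′ p′ q′ r′ g
Riccati-cong e≗ p≗ q≗ r≗ ric =
  ≗-trans (⊛-congʳ (⊛-congʳ (≗-sym e≗)))
  (≗-trans ric (⊕-cong (⊕-cong (⊛-congʳ p≗) (⊛-congʳ q≗)) (⊛-congʳ r≗)))

Riccati-cancel : ∀ {c e p q r g} → c 0 ≢ 0ℚ → Riccati (c ⊛ e) (c ⊛ p) (c ⊛ q) (c ⊛ r) g → Riccati e p q r g
Riccati-cancel {c} {e} {p} {q} {r} {g} c₀≢0 ric =
  f⊖g≗𝟘⇒f≗g _ _ (⊛-cancelˡ c₀≢0 (≗-trans factor (f≗g⇒f⊖g≗𝟘 ric)))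
  where
  open PS-Solver
  factor : c ⊛ (e ⊛ 1-9u² ⊛ (g ⊕ ⊖ θ g) ⊕ ⊖ (p ⊛ (g ⊛ g) ⊕ q ⊛ g ⊕ r ⊛ u²))
           ≗ c ⊛ e ⊛ 1-9u² ⊛ (g ⊕ ⊖ θ g) ⊕ ⊖ (c ⊛ p ⊛ (g ⊛ g) ⊕ c ⊛ q ⊛ g ⊕ c ⊛ r ⊛ u²)
  factor = solve 9 (λ c e p q r g G W S → c :* (e :* W :* (g :+ :- G) :+ :- (p :* (g :* g) :+ q :* g :+ r :* S))
                                    := c :* e :* W :* (g :+ :- G) :+ :- (c :* p :* (g :* g) :+ c :* q :* g :+ c :* r :* S))
                  (λ _ → refl) c e p q r g (θ g) 1-9u² u²

-- x ↦ b x − a t for constants a, b; the hypothesis p a + b q = b e kills the new constant term.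
Riccati-affine : ∀ {e p q r g a b} → θ a ≗ 𝟘 → θ b ≗ 𝟘 → p ⊛ a ⊕ b ⊛ q ≗ b ⊛ e → Riccati e p q r g →
                 Riccati (b ⊛ e) p (b ⊛ (e ⊕ e ⊕ ⊖ q)) (b ⊛ (b ⊛ r ⊕ ι (+ 9) ⊛ e ⊛ a)) (b ⊛ g ⊕ ⊖ a)
Riccati-affine {e} {p} {q} {r} {g} {a} {b} θa≗0 θb≗0 pa+bq≗be ric =
  f⊖g≗𝟘⇒f≗g _ _ (≗-trans (⊕-congʳ (⊖ rhs) (⊛-congˡ (⊕-congˡ h (⊖-cong θh≗bθg))))
                          (combination₂≗𝟘 certificate (f≗g⇒f⊖g≗𝟘 ric) (f≗g⇒f⊖g≗𝟘 pa+bq≗be)))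
  where
  open PS-Solver
  h rhs : PowerSeries
  h = b ⊛ g ⊕ ⊖ a
  rhs = p ⊛ (h ⊛ h) ⊕ b ⊛ (e ⊕ e ⊕ ⊖ q) ⊛ h ⊕ b ⊛ (b ⊛ r ⊕ ι (+ 9) ⊛ e ⊛ a) ⊛ u²
  θh≗bθg : θ h ≗ b ⊛ θ g
  θh≗bθg = ≗-trans (θ-⊕ _ _) (≗-trans (⊕-cong (≗-trans (θ-⊛ b g) (⊕-congʳ (b ⊛ θ g) (≗-trans (⊛-congʳ θb≗0) (𝟘-⊛ g))))
                                                (≗-trans (θ-⊖ a) (⊖-cong θa≗0)))
                                        (λ n → trans (+-identityʳ _) (+-identityˡ _)))
  certificate : b ⊛ e ⊛ 1-9u² ⊛ (h ⊕ ⊖ (b ⊛ θ g)) ⊕ ⊖ rhs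
                ≗ b ⊛ b ⊛ (e ⊛ 1-9u² ⊛ (g ⊕ ⊖ θ g) ⊕ ⊖ (p ⊛ (g ⊛ g) ⊕ q ⊛ g ⊕ r ⊛ u²))
                  ⊕ (ι (+ 2) ⊛ b ⊛ g ⊕ ⊖ a) ⊛ (p ⊛ a ⊕ b ⊛ q ⊕ ⊖ (b ⊛ e))
  certificate = solve 9 (λ e p q r g G a b S →
      b :* e :* (con (+ 1) :+ :- (con (+ 9) :* S)) :* ((b :* g :+ :- a) :+ :- (b :* G))
        :+ :- (p :* ((b :* g :+ :- a) :* (b :* g :+ :- a)) :+ b :* (e :+ e :+ :- q) :* (b :* g :+ :- a)
               :+ b :* (b :* r :+ con (+ 9) :* e :* a) :* S)
      := b :* b :* (e :* (con (+ 1) :+ :- (con (+ 9) :* S)) :* (g :+ :- G) :+ :- (p :* (g :* g) :+ q :* g :+ r :* S))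
        :+ (con (+ 2) :* b :* g :+ :- a) :* (p :* a :+ b :* q :+ :- (b :* e)))
    (λ _ → refl) e p q r g (θ g) a b u²

-- x ↦ 1/x, i.e. (t h)(t g) = 1, exchanges the roles of p and r.
Riccati-reciprocal : ∀ {e p q r h g} → h ⊛ g ≗ u² → Riccati e p q r h → Riccati e (⊖ r) (⊖ q) (⊖ p) g
Riccati-reciprocal {e} {p} {q} {r} {h} {g} hg≗u² ric =
  f⊖g≗𝟘⇒f≗g _ _ (u²⊛-cancel (combination₃≗𝟘 certificate (f≗g⇒f⊖g≗𝟘 ric) (f≗g⇒f⊖g≗𝟘 hg≗u²) (f≗g⇒f⊖g≗𝟘 leibniz)))
  where
  open PS-Solver
  leibniz : θ h ⊛ g ⊕ h ⊛ θ g ≗ ι (+ 2) ⊛ u²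
  leibniz = ≗-trans (≗-sym (θ-⊛ h g)) (≗-trans (θ-cong hg≗u²) θ-u²)
  certificate : u² ⊛ (e ⊛ 1-9u² ⊛ (g ⊕ ⊖ θ g) ⊕ ⊖ (⊖ r ⊛ (g ⊛ g) ⊕ ⊖ q ⊛ g ⊕ ⊖ p ⊛ u²))
                ≗ ⊖ (g ⊛ g) ⊛ (e ⊛ 1-9u² ⊛ (h ⊕ ⊖ θ h) ⊕ ⊖ (p ⊛ (h ⊛ h) ⊕ q ⊛ h ⊕ r ⊛ u²))
                  ⊕ (e ⊛ 1-9u² ⊛ (g ⊕ θ g) ⊕ ⊖ (p ⊛ (h ⊛ g ⊕ u²)) ⊕ ⊖ (q ⊛ g)) ⊛ (h ⊛ g ⊕ ⊖ u²)
                  ⊕ ⊖ (e ⊛ 1-9u² ⊛ g) ⊛ (θ h ⊛ g ⊕ h ⊛ θ g ⊕ ⊖ (ι (+ 2) ⊛ u²))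
  certificate = solve 9 (λ e p q r h H g G S →
      S :* (e :* (con (+ 1) :+ :- (con (+ 9) :* S)) :* (g :+ :- G) :+ :- (:- r :* (g :* g) :+ :- q :* g :+ :- p :* S))
      := :- (g :* g) :* (e :* (con (+ 1) :+ :- (con (+ 9) :* S)) :* (h :+ :- H) :+ :- (p :* (h :* h) :+ q :* h :+ r :* S))
        :+ (e :* (con (+ 1) :+ :- (con (+ 9) :* S)) :* (g :+ G) :+ :- (p :* (h :* g :+ S)) :+ :- (q :* g)) :* (h :* g :+ :- S)
        :+ :- (e :* (con (+ 1) :+ :- (con (+ 9) :* S)) :* g) :* (H :* g :+ h :* G :+ :- (con (+ 2) :* S)))
    (λ _ → refl) e p q r h (θ h) g (θ g) u²

-- The complete quotients

-- Integer data of the i-th complete quotient xᵢ: βᵢ and aᵢ = Aᵢ t, and the coefficients of its Riccati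
-- equation (t² − 9) xᵢ′ = Bᵢ xᵢ² + Qᵢ t xᵢ + Dᵢ.
βᶻ Aᶻ Bᶻ Qᶻ Dᶻ : ℕ → ℤ
βᶻ zero    = + 1
βᶻ (suc j) = (+ 3 ℤ.* + suc j ℤ.- + 1) ℤ.* (+ 3 ℤ.* + suc j ℤ.+ + 1)
Aᶻ zero    = + 1
Aᶻ (suc j) = sgn (suc j) ℤ.* (+ 2 ℤ.* + suc j ℤ.+ + 1)
Bᶻ zero    = + 1
Bᶻ (suc j) = sgn (suc j) ℤ.* βᶻ (suc j)
Qᶻ i       = ℤ.- (+ 2 ℤ.* + i)
Dᶻ zero    = -[1+ 0 ]
Dᶻ (suc j) = sgn (suc j)

β≡qz-βᶻ : ∀ i → β i ≡ qz (βᶻ i)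
β≡qz-βᶻ zero    = refl
β≡qz-βᶻ (suc j) = refl

sgn*sgn≡1 : ∀ i → sgn i ℤ.* sgn i ≡ + 1
sgn*sgn≡1 zero    = refl
sgn*sgn≡1 (suc i) = trans (square-neg (sgn i)) (sgn*sgn≡1 i)
  where
  square-neg : ∀ s → ℤ.- s ℤ.* ℤ.- s ≡ s ℤ.* s
  square-neg = ℤ-Tactic.solve-∀

constantTerm-vanishes : ∀ i → Bᶻ i ℤ.* Aᶻ i ℤ.+ βᶻ i ℤ.* Qᶻ i ≡ βᶻ i ℤ.* + 1
constantTerm-vanishes zero    = refl
constantTerm-vanishes (suc j) = begin
  s ℤ.* b ℤ.* (s ℤ.* (+ 2 ℤ.* n ℤ.+ + 1)) ℤ.+ b ℤ.* ℤ.- (+ 2 ℤ.* n)   ≡⟨ regroup s b n ⟩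
  s ℤ.* s ℤ.* (b ℤ.* (+ 2 ℤ.* n ℤ.+ + 1)) ℤ.+ b ℤ.* ℤ.- (+ 2 ℤ.* n)
    ≡⟨ cong (λ z → z ℤ.* (b ℤ.* (+ 2 ℤ.* n ℤ.+ + 1)) ℤ.+ b ℤ.* ℤ.- (+ 2 ℤ.* n)) (sgn*sgn≡1 (suc j)) ⟩
  + 1 ℤ.* (b ℤ.* (+ 2 ℤ.* n ℤ.+ + 1)) ℤ.+ b ℤ.* ℤ.- (+ 2 ℤ.* n)       ≡⟨ collapse b n ⟩
  b ℤ.* + 1                                                          ∎
  where
  open ≡-Reasoning
  s b n : ℤ
  s = sgn (suc j)
  b = βᶻ (suc j)
  n = + suc j
  regroup : ∀ s b n → s ℤ.* b ℤ.* (s ℤ.* (+ 2 ℤ.* n ℤ.+ + 1)) ℤ.+ b ℤ.* ℤ.- (+ 2 ℤ.* n)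
                      ≡ s ℤ.* s ℤ.* (b ℤ.* (+ 2 ℤ.* n ℤ.+ + 1)) ℤ.+ b ℤ.* ℤ.- (+ 2 ℤ.* n)
  regroup = ℤ-Tactic.solve-∀
  collapse : ∀ b n → + 1 ℤ.* (b ℤ.* (+ 2 ℤ.* n ℤ.+ + 1)) ℤ.+ b ℤ.* ℤ.- (+ 2 ℤ.* n) ≡ b ℤ.* + 1
  collapse = ℤ-Tactic.solve-∀

-- βᵢ₊₁ = βᵢ + 9(2i + 1), which makes the new leading coefficient  −βᵢ Dᵢ − 9 Aᵢ  equal to Bᵢ₊₁.
nextLeading : ∀ i → ℤ.- (βᶻ i ℤ.* (βᶻ i ℤ.* Dᶻ i ℤ.+ + 9 ℤ.* + 1 ℤ.* Aᶻ i)) ≡ βᶻ i ℤ.* Bᶻ (suc i)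
nextLeading zero    = refl
nextLeading (suc j) = identity (sgn (suc j)) (+ suc j)
  where
  identity : ∀ s n → ℤ.- (((+ 3 ℤ.* n ℤ.- + 1) ℤ.* (+ 3 ℤ.* n ℤ.+ + 1)) ℤ.* (((+ 3 ℤ.* n ℤ.- + 1) ℤ.* (+ 3 ℤ.* n ℤ.+ + 1)) ℤ.* s
                                ℤ.+ + 9 ℤ.* + 1 ℤ.* (s ℤ.* (+ 2 ℤ.* n ℤ.+ + 1))))
                     ≡ ((+ 3 ℤ.* n ℤ.- + 1) ℤ.* (+ 3 ℤ.* n ℤ.+ + 1))
                       ℤ.* (ℤ.- s ℤ.* ((+ 3 ℤ.* (+ 1 ℤ.+ n) ℤ.- + 1) ℤ.* (+ 3 ℤ.* (+ 1 ℤ.+ n) ℤ.+ + 1)))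
  identity = ℤ-Tactic.solve-∀

nextLinear : ∀ i → ℤ.- (βᶻ i ℤ.* (+ 1 ℤ.+ + 1 ℤ.+ ℤ.- Qᶻ i)) ≡ βᶻ i ℤ.* Qᶻ (suc i)
nextLinear i = identity (βᶻ i) (+ i)
  where
  identity : ∀ b n → ℤ.- (b ℤ.* (+ 1 ℤ.+ + 1 ℤ.+ ℤ.- ℤ.- (+ 2 ℤ.* n))) ≡ b ℤ.* ℤ.- (+ 2 ℤ.* (+ 1 ℤ.+ n))
  identity = ℤ-Tactic.solve-∀

nextConstant : ∀ i → ℤ.- Bᶻ i ≡ βᶻ i ℤ.* Dᶻ (suc i)
nextConstant zero    = refl
nextConstant (suc j) = identity (sgn (suc j)) (βᶻ (suc j))
  where
  identity : ∀ s b → ℤ.- (s ℤ.* b) ≡ b ℤ.* ℤ.- s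
  identity = ℤ-Tactic.solve-∀

βᶻ≢0 : ∀ i → βᶻ i ≢ + 0
βᶻ≢0 zero    ()
βᶻ≢0 (suc j) βᶻ≡0 = contradiction (trans (sym as-ℕ) βᶻ≡0) λ ()
  where
  as-ℕ : βᶻ (suc j) ≡ + ((2 ℕ.+ 3 ℕ.* j) ℕ.* (4 ℕ.+ 3 ℕ.* j))
  as-ℕ = begin
    βᶻ (suc j)                                        ≡⟨ expand (+ j) ⟩
    (+ 2 ℤ.+ + 3 ℤ.* + j) ℤ.* (+ 4 ℤ.+ + 3 ℤ.* + j)   ≡⟨ cong₂ (λ x y → (+ 2 ℤ.+ x) ℤ.* (+ 4 ℤ.+ y)) (ℤP.pos-* 3 j) (ℤP.pos-* 3 j) ⟨
    + (2 ℕ.+ 3 ℕ.* j) ℤ.* + (4 ℕ.+ 3 ℕ.* j)           ≡⟨ ℤP.pos-* (2 ℕ.+ 3 ℕ.* j) (4 ℕ.+ 3 ℕ.* j) ⟨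
    + ((2 ℕ.+ 3 ℕ.* j) ℕ.* (4 ℕ.+ 3 ℕ.* j))           ∎
    where
    open ≡-Reasoning
    expand : ∀ n → (+ 3 ℤ.* (+ 1 ℤ.+ n) ℤ.- + 1) ℤ.* (+ 3 ℤ.* (+ 1 ℤ.+ n) ℤ.+ + 1)
                   ≡ (+ 2 ℤ.+ + 3 ℤ.* n) ℤ.* (+ 4 ℤ.+ + 3 ℤ.* n)
    expand = ℤ-Tactic.solve-∀

Bᶻ≢0 : ∀ i → Bᶻ i ≢ + 0
Bᶻ≢0 zero    ()
Bᶻ≢0 (suc j) Bᶻ≡0 with ℤP.i*j≡0⇒i≡0∨j≡0 (sgn (suc j)) Bᶻ≡0
... | inj₁ s≡0 = contradiction (trans (sym (sgn*sgn≡1 (suc j))) (cong (λ s → s ℤ.* s) s≡0)) λ ()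
... | inj₂ β≡0 = βᶻ≢0 (suc j) β≡0

qz≢0 : ∀ {z} → z ≢ + 0 → qz z ≢ 0ℚ
qz≢0 z≢0 = z≢0 ∘ qz≡0⇒≡0

2-Qᶻ≢0 : ∀ i → qz (+ 2) - qz (Qᶻ i) ≢ 0ℚ
2-Qᶻ≢0 i e = qz-suc≢0 (suc (2 ℕ.* i)) (trans (sym as-qz) e)
  where
  as-qz : qz (+ 2) - qz (Qᶻ i) ≡ qz (+ suc (suc (2 ℕ.* i)))
  as-qz = begin
    qz (+ 2) - qz (Qᶻ i)                  ≡⟨ cong (_+_ (qz (+ 2))) (qz-homo‿- (Qᶻ i)) ⟨
    qz (+ 2) + qz (ℤ.- Qᶻ i)              ≡⟨ qz-homo-+ (+ 2) (ℤ.- Qᶻ i) ⟨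
    qz (+ 2 ℤ.+ ℤ.- Qᶻ i)                 ≡⟨ cong (λ z → qz (+ 2 ℤ.+ z)) (trans (ℤP.neg-involutive _) (sym (ℤP.pos-* 2 i))) ⟩
    qz (+ suc (suc (2 ℕ.* i)))            ∎
    where open ≡-Reasoning

ι-+ : ∀ i j → ι (i ℤ.+ j) ≗ ι i ⊕ ι j
ι-+ = ACR._-Raw-AlmostCommutative⟶_.+-homo ι-homomorphism

ι-* : ∀ i j → ι (i ℤ.* j) ≗ ι i ⊛ ι j
ι-* = ACR._-Raw-AlmostCommutative⟶_.*-homo ι-homomorphism

ι-‿ : ∀ i → ι (ℤ.- i) ≗ ⊖ ι i
ι-‿ = ACR._-Raw-AlmostCommutative⟶_.-‿homo ι-homomorphism

ι-cong : ∀ {i j} → i ≡ j → ι i ≗ ι j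
ι-cong refl = ≗-refl

ι-constantTerm-vanishes : ∀ i → ι (Bᶻ i) ⊛ ι (Aᶻ i) ⊕ ι (βᶻ i) ⊛ ι (Qᶻ i) ≗ ι (βᶻ i) ⊛ ι (+ 1)
ι-constantTerm-vanishes i = begin
  ι (Bᶻ i) ⊛ ι (Aᶻ i) ⊕ ι (βᶻ i) ⊛ ι (Qᶻ i)     ≈⟨ ⊕-cong (ι-* (Bᶻ i) (Aᶻ i)) (ι-* (βᶻ i) (Qᶻ i)) ⟨
  ι (Bᶻ i ℤ.* Aᶻ i) ⊕ ι (βᶻ i ℤ.* Qᶻ i)         ≈⟨ ι-+ (Bᶻ i ℤ.* Aᶻ i) (βᶻ i ℤ.* Qᶻ i) ⟨
  ι (Bᶻ i ℤ.* Aᶻ i ℤ.+ βᶻ i ℤ.* Qᶻ i)           ≈⟨ ι-cong (constantTerm-vanishes i) ⟩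
  ι (βᶻ i ℤ.* + 1)                              ≈⟨ ι-* (βᶻ i) (+ 1) ⟩
  ι (βᶻ i) ⊛ ι (+ 1)                            ∎
  where open ≗-Reasoning

ι-nextLeading : ∀ i → ⊖ (ι (βᶻ i) ⊛ (ι (βᶻ i) ⊛ ι (Dᶻ i) ⊕ ι (+ 9) ⊛ ι (+ 1) ⊛ ι (Aᶻ i))) ≗ ι (βᶻ i) ⊛ ι (Bᶻ (suc i))
ι-nextLeading i = begin
  ⊖ (ι b ⊛ (ι b ⊛ ι d ⊕ ι (+ 9) ⊛ ι (+ 1) ⊛ ι a′))
    ≈⟨ ⊖-cong (⊛-congˡ (⊕-cong (ι-* b d) (≗-trans (ι-* (+ 9 ℤ.* + 1) a′) (⊛-congʳ (ι-* (+ 9) (+ 1)))))) ⟨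
  ⊖ (ι b ⊛ (ι (b ℤ.* d) ⊕ ι (+ 9 ℤ.* + 1 ℤ.* a′)))    ≈⟨ ⊖-cong (⊛-congˡ (ι-+ (b ℤ.* d) (+ 9 ℤ.* + 1 ℤ.* a′))) ⟨
  ⊖ (ι b ⊛ ι (b ℤ.* d ℤ.+ + 9 ℤ.* + 1 ℤ.* a′))       ≈⟨ ⊖-cong (ι-* b (b ℤ.* d ℤ.+ + 9 ℤ.* + 1 ℤ.* a′)) ⟨
  ⊖ ι (b ℤ.* (b ℤ.* d ℤ.+ + 9 ℤ.* + 1 ℤ.* a′))       ≈⟨ ι-‿ (b ℤ.* (b ℤ.* d ℤ.+ + 9 ℤ.* + 1 ℤ.* a′)) ⟨
  ι (ℤ.- (b ℤ.* (b ℤ.* d ℤ.+ + 9 ℤ.* + 1 ℤ.* a′)))   ≈⟨ ι-cong (nextLeading i) ⟩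
  ι (b ℤ.* Bᶻ (suc i))                              ≈⟨ ι-* b (Bᶻ (suc i)) ⟩
  ι b ⊛ ι (Bᶻ (suc i))                              ∎
  where
  open ≗-Reasoning
  b d a′ : ℤ
  b = βᶻ i
  d = Dᶻ i
  a′ = Aᶻ i

ι-nextLinear : ∀ i → ⊖ (ι (βᶻ i) ⊛ (ι (+ 1) ⊕ ι (+ 1) ⊕ ⊖ ι (Qᶻ i))) ≗ ι (βᶻ i) ⊛ ι (Qᶻ (suc i))
ι-nextLinear i = begin
  ⊖ (ι b ⊛ (ι (+ 1) ⊕ ι (+ 1) ⊕ ⊖ ι q))          ≈⟨ ⊖-cong (⊛-congˡ (⊕-cong (ι-+ (+ 1) (+ 1)) (ι-‿ q))) ⟨
  ⊖ (ι b ⊛ (ι (+ 1 ℤ.+ + 1) ⊕ ι (ℤ.- q)))        ≈⟨ ⊖-cong (⊛-congˡ (ι-+ (+ 1 ℤ.+ + 1) (ℤ.- q))) ⟨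
  ⊖ (ι b ⊛ ι (+ 1 ℤ.+ + 1 ℤ.+ ℤ.- q))            ≈⟨ ⊖-cong (ι-* b (+ 1 ℤ.+ + 1 ℤ.+ ℤ.- q)) ⟨
  ⊖ ι (b ℤ.* (+ 1 ℤ.+ + 1 ℤ.+ ℤ.- q))            ≈⟨ ι-‿ (b ℤ.* (+ 1 ℤ.+ + 1 ℤ.+ ℤ.- q)) ⟨
  ι (ℤ.- (b ℤ.* (+ 1 ℤ.+ + 1 ℤ.+ ℤ.- q)))        ≈⟨ ι-cong (nextLinear i) ⟩
  ι (b ℤ.* Qᶻ (suc i))                           ≈⟨ ι-* b (Qᶻ (suc i)) ⟩
  ι b ⊛ ι (Qᶻ (suc i))                           ∎
  where
  open ≗-Reasoning
  b q : ℤ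
  b = βᶻ i
  q = Qᶻ i

ι-nextConstant : ∀ i → ⊖ ι (Bᶻ i) ≗ ι (βᶻ i) ⊛ ι (Dᶻ (suc i))
ι-nextConstant i = ≗-trans (≗-sym (ι-‿ (Bᶻ i))) (≗-trans (ι-cong (nextConstant i)) (ι-* (βᶻ i) (Dᶻ (suc i))))

riccati-pointwise : ∀ {E P Q R g} → Riccati (ι E) (ι P) (ι Q) (ι R) g → ∀ n →
  qz E * ((g ⊕ ⊖ θ g) n + - (q9 * shift (shift (g ⊕ ⊖ θ g)) n)) ≡ qz P * (g ⊛ g) n + qz Q * g n + qz R * u² n
riccati-pointwise {E} {P} {Q} {R} {g} ric n = begin
  qz E * (G n + - (q9 * shift (shift G) n))      ≡⟨ lhs n ⟨
  (ι E ⊛ 1-9u² ⊛ G) n                            ≡⟨ ric n ⟩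
  (ι P ⊛ (g ⊛ g) ⊕ ι Q ⊛ g ⊕ ι R ⊛ u²) n         ≡⟨ cong₂ _+_ (cong₂ _+_ (ι-⊛ P (g ⊛ g) n) (ι-⊛ Q g n)) (ι-⊛ R u² n) ⟩
  qz P * (g ⊛ g) n + qz Q * g n + qz R * u² n    ∎
  where
  open ≡-Reasoning
  G : PowerSeries
  G = g ⊕ ⊖ θ g
  expand : ι E ⊛ 1-9u² ⊛ G ≗ ι E ⊛ (G ⊕ ⊖ (ι (+ 9) ⊛ (u² ⊛ G)))
  expand = solve 3 (λ e S G → e :* (con (+ 1) :+ :- (con (+ 9) :* S)) :* G := e :* (G :+ :- (con (+ 9) :* (S :* G))))
                  (λ _ → refl) (ι E) u² G
    where open PS-Solver
  lhs : ι E ⊛ 1-9u² ⊛ G ≗ qz E ⊙ (G ⊕ ⊖ (q9 ⊙ shift (shift G)))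
  lhs = ≗-trans expand (≗-trans (ι-⊛ E _) (λ n → cong (λ x → qz E * (G n + - x))
          (trans (ι-⊛ (+ 9) (u² ⊛ G) n) (cong (q9 *_) (sym (shift²≗u²⊛ G n))))))

represents-hasDeg : ∀ {x d f} → Represents x d f → f 0 ≢ 0ℚ → HasDeg x d
represents-hasDeg {x} {d} {f} r f₀≢0 =
  (λ e → f₀≢0 (trans (sym (trans (coeff-≡ r d) (cong (coeffAt f) (ℤP.i≡j⇒i-j≡0 {d} refl)))) e)) ,
  (λ k d<k → trans (coeff-≡ r k) (coeffAt-above f d k d<k))

module Step (i : ℕ) (g : PowerSeries) (g₀≢0 : g 0 ≢ 0ℚ)
            (riccati : Riccati (ι (+ 1)) (ι (Bᶻ i)) (ι (Qᶻ i)) (ι (Dᶻ i)) g) where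

  private
    βᵢ Aᵢ Bᵢ Qᵢ Dᵢ : ℚ
    βᵢ = qz (βᶻ i)
    Aᵢ = qz (Aᶻ i)
    Bᵢ = qz (Bᶻ i)
    Qᵢ = qz (Qᶻ i)
    Dᵢ = qz (Dᶻ i)

    βᵢ≢0 : βᵢ ≢ 0ℚ
    βᵢ≢0 = qz≢0 (βᶻ≢0 i)

    order₀ : qz (+ 1) * (g 0 + - (qz (+ 0) * g 0) + - (q9 * 0ℚ)) ≡ Bᵢ * (g 0 * g 0) + Qᵢ * g 0 + Dᵢ * 0ℚ
    order₀ = riccati-pointwise {+ 1} {Bᶻ i} {Qᶻ i} {Dᶻ i} riccati 0

    order₁ : qz (+ 1) * (g 1 + - (qz (+ 1) * g 1) + - (q9 * 0ℚ)) ≡ Bᵢ * (g 0 * g 1 + g 1 * g 0) + Qᵢ * g 1 + Dᵢ * 0ℚ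
    order₁ = riccati-pointwise {+ 1} {Bᶻ i} {Qᶻ i} {Dᶻ i} riccati 1

    order₂ : qz (+ 1) * (g 2 + - (qz (+ 2) * g 2) + - (q9 * (g 0 + - (qz (+ 0) * g 0))))
             ≡ Bᵢ * ((g 0 * g 2 + g 1 * g 1) + g 2 * g 0) + Qᵢ * g 2 + Dᵢ * 1ℚ
    order₂ = riccati-pointwise {+ 1} {Bᶻ i} {Qᶻ i} {Dᶻ i} riccati 2

    Bg₀≡1-Q : Bᵢ * g 0 ≡ 1ℚ - Qᵢ
    Bg₀≡1-Q = p-q≡0⇒p≡q _ _ (p*q≡0⇒q≡0 g₀≢0 (trans (rearrange (g 0) Bᵢ Qᵢ Dᵢ) (p≡q⇒p-q≡0 (sym order₀))))
      where
      rearrange : ∀ x b q d → x * (b * x - (1ℚ - q)) ≡ (b * (x * x) + q * x + d * 0ℚ) - qz (+ 1) * (x + - (qz (+ 0) * x) + - (q9 * 0ℚ))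
      rearrange = solve-∀ ℚ-ring

    βg₀≡A : βᵢ * g 0 ≡ Aᵢ
    βg₀≡A = p-q≡0⇒p≡q _ _ (p*q≡0⇒q≡0 (qz≢0 (Bᶻ≢0 i)) (begin
      Bᵢ * (βᵢ * g 0 - Aᵢ)                                              ≡⟨ rearrange Bᵢ βᵢ Aᵢ Qᵢ (g 0) ⟩
      βᵢ * (Bᵢ * g 0 - (1ℚ - Qᵢ)) + (βᵢ * 1ℚ * 1ℚ - (Bᵢ * 1ℚ * (Aᵢ * 1ℚ) + βᵢ * 1ℚ * (Qᵢ * 1ℚ)))
        ≡⟨ cong₂ (λ x y → βᵢ * x + y) (p≡q⇒p-q≡0 Bg₀≡1-Q) (p≡q⇒p-q≡0 (sym (ι-constantTerm-vanishes i 0))) ⟩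
      βᵢ * 0ℚ + 0ℚ                                                      ≡⟨ cong (_+ 0ℚ) (*-zeroʳ βᵢ) ⟩
      0ℚ                                                                ∎))
      where
      open ≡-Reasoning
      rearrange : ∀ b β a q x → b * (β * x - a) ≡ β * (b * x - (1ℚ - q)) + (β * 1ℚ * 1ℚ - (b * 1ℚ * (a * 1ℚ) + β * 1ℚ * (q * 1ℚ)))
      rearrange = solve-∀ ℚ-ring

    g₁≡0 : g 1 ≡ 0ℚ
    g₁≡0 = p*q≡0⇒q≡0 (2-Qᶻ≢0 i) (begin
      (qz (+ 2) - Qᵢ) * g 1                                   ≡⟨ rearrange (g 0) (g 1) Bᵢ Qᵢ Dᵢ ⟩
      (rhs - lhs) - qz (+ 2) * g 1 * (Bᵢ * g 0 - (1ℚ - Qᵢ))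
        ≡⟨ cong₂ (λ x y → x - qz (+ 2) * g 1 * y) (p≡q⇒p-q≡0 (sym order₁)) (p≡q⇒p-q≡0 Bg₀≡1-Q) ⟩
      0ℚ - qz (+ 2) * g 1 * 0ℚ                                ≡⟨ cong (_-_ 0ℚ) (*-zeroʳ (qz (+ 2) * g 1)) ⟩
      0ℚ                                                      ∎)
      where
      open ≡-Reasoning
      lhs rhs : ℚ
      lhs = qz (+ 1) * (g 1 + - (qz (+ 1) * g 1) + - (q9 * 0ℚ))
      rhs = Bᵢ * (g 0 * g 1 + g 1 * g 0) + Qᵢ * g 1 + Dᵢ * 0ℚ
      rearrange : ∀ x y b q d → (qz (+ 2) - q) * y
        ≡ ((b * (x * y + y * x) + q * y + d * 0ℚ) - qz (+ 1) * (y + - (qz (+ 1) * y) + - (q9 * 0ℚ))) - qz (+ 2) * y * (b * x - (1ℚ - q))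
      rearrange = solve-∀ ℚ-ring

    -- The coefficient of u² in the Riccati equation gives (3 − Qᵢ) g₂ = −9 g₀ − Dᵢ, and βᵢ times the
    -- right-hand side is Bᵢ₊₁ ≠ 0.
    g₂≢0 : g 2 ≢ 0ℚ
    g₂≢0 g₂≡0 = p≢0∧q≢0⇒p*q≢0 βᵢ≢0 (qz≢0 (Bᶻ≢0 (suc i))) (begin
      βᵢ * B′                                                      ≡⟨ pad βᵢ B′ ⟩
      βᵢ * 1ℚ * (B′ * 1ℚ)                                          ≡⟨ ι-nextLeading i 0 ⟨
      - (βᵢ * 1ℚ * (βᵢ * 1ℚ * (Dᵢ * 1ℚ) + q9 * 1ℚ * (qz (+ 1) * 1ℚ) * (Aᵢ * 1ℚ)))
        ≡⟨ cong (λ a → - (βᵢ * 1ℚ * (βᵢ * 1ℚ * (Dᵢ * 1ℚ) + q9 * 1ℚ * (qz (+ 1) * 1ℚ) * (a * 1ℚ)))) (sym βg₀≡A) ⟩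
      - (βᵢ * 1ℚ * (βᵢ * 1ℚ * (Dᵢ * 1ℚ) + q9 * 1ℚ * (qz (+ 1) * 1ℚ) * (βᵢ * g 0 * 1ℚ)))
        ≡⟨ factor βᵢ Dᵢ (g 0) ⟩
      - (βᵢ * βᵢ) * (Dᵢ + q9 * g 0)                                ≡⟨ cong (- (βᵢ * βᵢ) *_) D+9g₀≡0 ⟩
      - (βᵢ * βᵢ) * 0ℚ                                             ≡⟨ *-zeroʳ (- (βᵢ * βᵢ)) ⟩
      0ℚ                                                           ∎)
      where
      open ≡-Reasoning
      B′ : ℚ
      B′ = qz (Bᶻ (suc i))
      pad : ∀ b c → b * c ≡ b * 1ℚ * (c * 1ℚ)
      pad = solve-∀ ℚ-ring
      factor : ∀ b d x → - (b * 1ℚ * (b * 1ℚ * (d * 1ℚ) + q9 * 1ℚ * (qz (+ 1) * 1ℚ) * (b * x * 1ℚ))) ≡ - (b * b) * (d + q9 * x)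
      factor = solve-∀ ℚ-ring
      order₂′ : qz (+ 1) * (0ℚ + - (qz (+ 2) * 0ℚ) + - (q9 * (g 0 + - (qz (+ 0) * g 0))))
                ≡ Bᵢ * ((g 0 * 0ℚ + 0ℚ * 0ℚ) + 0ℚ * g 0) + Qᵢ * 0ℚ + Dᵢ * 1ℚ
      order₂′ = subst₂ (λ y z → qz (+ 1) * (z + - (qz (+ 2) * z) + - (q9 * (g 0 + - (qz (+ 0) * g 0))))
                                ≡ Bᵢ * ((g 0 * z + y * y) + z * g 0) + Qᵢ * z + Dᵢ * 1ℚ) g₁≡0 g₂≡0 order₂
      D+9g₀≡0 : Dᵢ + q9 * g 0 ≡ 0ℚ
      D+9g₀≡0 = trans (rearrange (g 0) Bᵢ Qᵢ Dᵢ) (p≡q⇒p-q≡0 (sym order₂′))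
        where
        rearrange : ∀ x b q d → d + q9 * x ≡ (b * ((x * 0ℚ + 0ℚ * 0ℚ) + 0ℚ * x) + q * 0ℚ + d * 1ℚ)
                                           - qz (+ 1) * (0ℚ + - (qz (+ 2) * 0ℚ) + - (q9 * (x + - (qz (+ 0) * x))))
        rearrange = solve-∀ ℚ-ring

  -- the series with  βᵢ xᵢ − aᵢ = t·h(t⁻¹)
  h : PowerSeries
  h = ι (βᶻ i) ⊛ g ⊕ ⊖ ι (Aᶻ i)

  h≗βg-a : h ≗ β i ⊙ g ⊕ (- 1ℚ) ⊙ ι (Aᶻ i)
  h≗βg-a n = cong₂ _+_ (trans (ι-⊛ (βᶻ i) g n) (cong (_* g n) (sym (β≡qz-βᶻ i))))
                       (sym (trans (sym (neg-distribˡ-* 1ℚ (ι (Aᶻ i) n))) (cong -_ (*-identityˡ (ι (Aᶻ i) n)))))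

  private
    h-pointwise : ∀ n → h n ≡ βᵢ * g n + - (Aᵢ * 𝟙 n)
    h-pointwise n = cong (_+ - (Aᵢ * 𝟙 n)) (ι-⊛ (βᶻ i) g n)

  -- βᵢ xᵢ − aᵢ = t⁻¹·k(t⁻¹)
  k : PowerSeries
  k n = h (suc (suc n))

  h≗shift²k : h ≗ shift (shift k)
  h≗shift²k zero = trans (h-pointwise 0) (trans (cong (λ x → x + - (Aᵢ * 1ℚ)) βg₀≡A) (cancel Aᵢ))
    where
    cancel : ∀ a → a + - (a * 1ℚ) ≡ 0ℚ
    cancel = solve-∀ ℚ-ring
  h≗shift²k (suc zero) = trans (h-pointwise 1) (trans (cong (λ x → βᵢ * x + - (Aᵢ * 0ℚ)) g₁≡0) (vanish βᵢ Aᵢ))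
    where
    vanish : ∀ b a → b * 0ℚ + - (a * 0ℚ) ≡ 0ℚ
    vanish = solve-∀ ℚ-ring
  h≗shift²k (suc (suc n)) = refl

  k₀≢0 : k 0 ≢ 0ℚ
  k₀≢0 k₀≡0 = p≢0∧q≢0⇒p*q≢0 βᵢ≢0 g₂≢0 (trans (drop (βᵢ * g 2) Aᵢ) (trans (sym (h-pointwise 2)) k₀≡0))
    where
    drop : ∀ x a → x ≡ x + - (a * 0ℚ)
    drop = solve-∀ ℚ-ring

  open Inverse k k₀≢0 public using (k⁻¹; ⊛-inverseʳ; k⁻¹₀≢0)

  riccati-next : Riccati (ι (+ 1)) (ι (Bᶻ (suc i))) (ι (Qᶻ (suc i))) (ι (Dᶻ (suc i))) k⁻¹
  riccati-next = Riccati-cancel βᵢ*1≢0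
    (Riccati-cong ≗-refl (ι-nextLeading i) (ι-nextLinear i) (ι-nextConstant i)
      (Riccati-reciprocal hk⁻¹≗u² (Riccati-affine (θ-ι (Aᶻ i)) (θ-ι (βᶻ i)) (ι-constantTerm-vanishes i) riccati)))
    where
    βᵢ*1≢0 : βᵢ * 1ℚ ≢ 0ℚ
    βᵢ*1≢0 = p≢0∧q≢0⇒p*q≢0 βᵢ≢0 λ ()
    hk⁻¹≗u² : h ⊛ k⁻¹ ≗ u²
    hk⁻¹≗u² = ≗-trans (⊛-congʳ (≗-trans h≗shift²k (shift²≗u²⊛ k)))
              (≗-trans (⊛-assoc u² k k⁻¹) (≗-trans (⊛-congˡ ⊛-inverseʳ) (λ n → trans (⊛-comm u² 𝟙 n) (𝟙-⊛ u² n))))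

record CompleteQuotient (i : ℕ) : Set where
  field
    series    : PowerSeries
    series₀≢0 : series 0 ≢ 0ℚ
    riccati   : Riccati (ι (+ 1)) (ι (Bᶻ i)) (ι (Qᶻ i)) (ι (Dᶻ i)) series

completeQuotient : ∀ i → CompleteQuotient i
completeQuotient zero    = record
  { series    = cubicRoot
  ; series₀≢0 = λ e → 1≢0 (trans (sym cubicRoot₀≡1) e)
  ; riccati   = cubicRoot-riccati
  }
completeQuotient (suc i) = record
  { series    = k⁻¹
  ; series₀≢0 = k⁻¹₀≢0
  ; riccati   = riccati-next
  }
  where
  open CompleteQuotient (completeQuotient i)
  open Step i series series₀≢0 riccati

quotient : ℕ → Laurent
quotient i = lau (+ 1) (CompleteQuotient.series (completeQuotient i))

a-represents : ∀ i → Represents (a i) (+ 1) (ι (Aᶻ i))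
a-represents zero    = represents-cong (λ n → sym (*-identityˡ (𝟙 n))) tL-represents
a-represents (suc j) = represents-·L (qz (Aᶻ (suc j))) tL-represents

continuedFraction-step : ∀ i →
  Σ ℤ (λ d → (d ℤ.< + 0) × HasDeg (β i ·L quotient i -L a i) d) × ((β i ·L quotient i -L a i) *L quotient (suc i) ≈ 1L)
continuedFraction-step i = (-[1+ 0 ] , -<+ , represents-hasDeg y-represents k₀≢0) , represents⇒≈ y·x′-represents 1L-represents
  where
  open CompleteQuotient (completeQuotient i)
  open Step i series series₀≢0 riccati
  y-represents : Represents (β i ·L quotient i -L a i) -[1+ 0 ] k
  y-represents = represents-unshift {N = -[1+ 0 ]} (represents-unshift {N = + 0}
    (represents-cong (≗-trans (≗-sym h≗βg-a) h≗shift²k)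
      (represents-+L (represents-·L (β i) (lau-represents (+ 1) series)) (represents-·L (- 1ℚ) (a-represents i)))))
  y·x′-represents : Represents ((β i ·L quotient i -L a i) *L quotient (suc i)) (+ 0) 𝟙
  y·x′-represents = represents-cong ⊛-inverseʳ (represents-*L y-represents (lau-represents (+ 1) k⁻¹))

root : Laurent
root = quotient 0

root-represents : Represents root (+ 1) cubicRoot
root-represents = lau-represents (+ 1) cubicRoot

root-solves : cubic root ≈ 0L
root-solves = represents-0L (cubic-represents 0 root-represents) cubicSeries-cubicRoot≗𝟘

root-hasDeg : HasDeg root (+ 1)
root-hasDeg = represents-hasDeg root-represents λ e → 1≢0 (trans (sym cubicRoot₀≡1) e)

-- Uniqueness

private
  cube≡0⇒≡0 : ∀ {x} → q3 * (x * (x * x)) ≡ 0ℚ → x ≡ 0ℚ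
  cube≡0⇒≡0 {x} e with x ≟ 0ℚ
  ... | yes x≡0 = x≡0
  ... | no  x≢0 = contradiction e (p≢0∧q≢0⇒p*q≢0 {q3} (λ ()) (p≢0∧q≢0⇒p*q≢0 x≢0 (p≢0∧q≢0⇒p*q≢0 x≢0 x≢0)))

cubicSeries-suc≗𝟘⇒f₀≡0 : ∀ m f → cubicSeries (suc m) f ≗ 𝟘 → f 0 ≡ 0ℚ
cubicSeries-suc≗𝟘⇒f₀≡0 m f vanishes = cube≡0⇒≡0 (trans (rearrange (f 0)) (vanishes 0))
  where
  rearrange : ∀ x → q3 * (x * (x * x)) ≡ q3 * (x * x * x) + - 1ℚ * (q3 * 0ℚ) + q9 * 0ℚ + - 1ℚ * 0ℚ
  rearrange = solve-∀ ℚ-ring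

cubicSeries≗𝟘⇒f₀≡1 : ∀ f → cubicSeries 0 f ≗ 𝟘 → f 0 ≢ 0ℚ → f 0 ≡ 1ℚ
cubicSeries≗𝟘⇒f₀≡1 f vanishes f₀≢0 =
  p-q≡0⇒p≡q _ _ (p*q≡0⇒q≡0 f₀≢0 (p*q≡0⇒q≡0 f₀≢0 (p*q≡0⇒q≡0 {q3} (λ ()) (trans (rearrange (f 0)) (vanishes 0)))))
  where
  rearrange : ∀ x → q3 * (x * (x * (x - 1ℚ))) ≡ q3 * (x * x * x) + - 1ℚ * (q3 * (1ℚ * x * x)) + q9 * 0ℚ + - 1ℚ * 0ℚ
  rearrange = solve-∀ ℚ-ring

hasDeg-represents : ∀ {y m} → HasDeg y (+ suc m) → Σ PowerSeries λ f → Represents y (+ suc m) f × f 0 ≢ 0ℚ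
hasDeg-represents {y} {m} (c≢0 , vanish) =
  _ , truncation-represents y (+ suc m) vanish , c≢0 ∘ trans (cong (coeff y) (sym (ℤP.+-identityʳ (+ suc m))))

solution-unique : ∀ y → (Σ ℤ λ d → (+ 0 ℤ.< d) × HasDeg y d) → cubic y ≈ 0L → y ≈ root
solution-unique y (+ zero , +<+ () , _)
solution-unique y (+ suc zero , _ , deg) y-solves = degreeOne (hasDeg-represents deg)
  where
  degreeOne : (Σ PowerSeries λ f → Represents y (+ 1) f × f 0 ≢ 0ℚ) → y ≈ root
  degreeOne (f , r , f₀≢0) = represents⇒≈ (represents-cong (cubicRoot-unique f f-solves f₀≡1) r) root-represents
    where
    f-solves : cubicSeries 0 f ≗ 𝟘
    f-solves = ≈0L⇒represents-𝟘 y-solves (cubic-represents 0 r)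
    f₀≡1 : f 0 ≡ 1ℚ
    f₀≡1 = cubicSeries≗𝟘⇒f₀≡1 f f-solves f₀≢0
solution-unique y (+ suc (suc m) , _ , deg) y-solves = higherDegree (hasDeg-represents deg)
  where
  higherDegree : (Σ PowerSeries λ f → Represents y (+ suc (suc m)) f × f 0 ≢ 0ℚ) → y ≈ root
  higherDegree (f , r , f₀≢0) =
    contradiction (cubicSeries-suc≗𝟘⇒f₀≡0 m f (≈0L⇒represents-𝟘 y-solves (cubic-represents (suc m) r))) f₀≢0

mainTheorem5 : Σ Laurent λ x →
    ((Σ ℤ λ d → (+ 0 ℤ.< d) × HasDeg x d) × (cubic x ≈ 0L))
    × (∀ y → (Σ ℤ λ d → (+ 0 ℤ.< d) × HasDeg y d) → cubic y ≈ 0L → y ≈ x)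
    × HasCF x β a
mainTheorem5 =
  root , ((+ 1 , +<+ (s≤s z≤n) , root-hasDeg) , root-solves) , solution-unique , (quotient , (λ _ → refl) , continuedFraction-step)
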